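{- Let $m\ge 1$. For each integer $k$ with $m^2\le k\le 3m^2-4m+2$, there exists a matrix in $\Lambda_{2m}^m$ having a critical set of size $k$.
   Context: $\Lambda_{n}^{x}$ is the set of $n\times n$ $(0,1)$-matrices with every row sum and every column sum equal to $x$. A matrix $M$ is identified with the set of triples $\{(i,j,M_{ij})\}$. A subset $D\subseteq M$ is a defining set for $M$ if $M$ is the unique element of $\Lambda_{2m}^m$ containing $D$; a critical set is a defining set none of whose proper subsets is a defining set; its size is its number of triples. -}

module Defs where

open import Data.Nat using (ℕ; zero; suc; _+_; _*_)
open import Data.Bool using (Bool; true; false)
open import Data.Fin using (Fin; zero; suc)
open import Data.Product using (Σ; _×_; ∃-syntax)
open import Relation.Binary.PropositionalEquality using (_≡_)
open import Relation.Nullary using (¬_)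

Matrix : ℕ → Set
Matrix n = Fin n → Fin n → Bool

b2n : Bool → ℕ
b2n true  = 1
b2n false = 0

count : ∀ {n} → (Fin n → Bool) → ℕ
count {zero}  f = 0
count {suc n} f = b2n (f zero) + count (λ i → f (suc i))

InΛ : (n x : ℕ) → Matrix n → Set
InΛ n x M = (∀ i → count (M i) ≡ x) × (∀ j → count (λ i → M i j) ≡ x)

-- A subset D of (the triple set of) M is determined by the set of cells
-- (i,j) it uses: D = {(i,j,M i j) | S i j ≡ true}.
Cells : ℕ → Set
Cells n = Fin n → Fin n → Bool

sizeRows : ∀ {r c} → (Fin r → Fin c → Bool) → ℕ
sizeRows {zero}  S = 0
sizeRows {suc r} S = count (S zero) + sizeRows (λ i → S (suc i))

size : ∀ {n} → Cells n → ℕ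
size S = sizeRows S

Contains : ∀ {n} → Matrix n → Matrix n → Cells n → Set
Contains M M' S = ∀ i j → S i j ≡ true → M' i j ≡ M i j

IsDefining : (m : ℕ) → Matrix (2 * m) → Cells (2 * m) → Set
IsDefining m M S =
  InΛ (2 * m) m M ×
  (∀ (M' : Matrix (2 * m)) → InΛ (2 * m) m M' → Contains M M' S →
     ∀ i j → M' i j ≡ M i j)

ProperSubset : ∀ {n} → Cells n → Cells n → Set
ProperSubset {n} S' S =
  (∀ i j → S' i j ≡ true → S i j ≡ true) ×
  ∃[ i ] ∃[ j ] (S i j ≡ true × S' i j ≡ false)

IsCritical : (m : ℕ) → Matrix (2 * m) → Cells (2 * m) → Set
IsCritical m M S =
  IsDefining m M S × (∀ S' → ProperSubset S' S → ¬ IsDefining m M S')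

module Submission where

-- For a matrix M let back M be the set of its 1s strictly below the diagonal
-- together with its 0s strictly above it.
--   * back M is always a defining set: the lines of M can be recovered in the
--     order 0, 1, 2, …, each one being squeezed by its line sum.
--   * back M is critical when every cell of it is essential, i.e. can be
--     changed by switching a set that alternates 1/0 in every line it meets and
--     contains no other cell of back M.  For "shaped" matrices (0s on the
--     subdiagonal, 1s on the diagonal except possibly at the very end) each
--     cell of back M closes such a staircase along the diagonal.
--   * A family of circulants D m q r (q, r < m) is shaped, and a row-by-row
--     count in offset coordinates gives |back| = m² + 2(q(m−1) + r): every
--     even excess up to 2(m−1)².
--   * One interchange through the last diagonal cell keeps a circulant shaped
--     and changes |back| by +1 or −1: every odd excess.
-- The theorem writes k = m² + d with d ≤ 2(m−1)² and splits on the parity of d.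

open import Defs
open import Data.Nat using (ℕ; zero; suc; _+_; _*_; _∸_; _≤_; _<_; z≤n; s≤s; _≤?_; _<?_)
open import Data.Nat.Properties
open import Data.Bool using (Bool; true; false; not; _∧_; _∨_; _xor_)
open import Data.Bool.Properties using (not-involutive)
open import Data.Fin using (Fin; zero; suc; toℕ; fromℕ<; inject₁) renaming (_≟_ to _≟ᶠ_)
open import Data.Fin.Properties using (toℕ-injective; toℕ-fromℕ<; toℕ<n; toℕ-inject₁) renaming (suc-injective to fsuc-injective)
open import Data.Fin.Permutation using (Permutation′; permutation; transpose; _⟨$⟩ʳ_)
import Data.Fin.Permutation.Components as PermutationComponents
open import Data.Product using (Σ; _×_; _,_; proj₁; proj₂; ∃-syntax)
open import Data.Sum using (_⊎_; inj₁; inj₂; [_,_]′)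
open import Data.Empty using (⊥; ⊥-elim)
open import Relation.Binary.PropositionalEquality
open import Relation.Binary using (Tri; tri<; tri≈; tri>)
open import Relation.Nullary using (¬_; Dec; yes; no; does)
open import Relation.Nullary.Decidable using (dec-true; dec-false; does-⇔; _×-dec_; _⊎-dec_; ¬?)
open import Function.Base using (_∘_)
open import Function.Bundles using (mk⇔)
import Algebra.Properties.CommutativeMonoid.Sum as MonoidSum
open import Data.Nat.Tactic.RingSolver using (solve-∀)
open import Data.Nat.DivMod using (_/_; _%_; m≡m%n+[m/n]*n; m%n<n; m/n*n≤m)

clash : ∀ {A : Set} {b : Bool} → b ≡ true → b ≡ false → A
clash refl ()

-- Counting the 1s of Boolean vectors

-- `count` is the sum of the 0/1 values, which lets us reuse the library's
-- facts about sums in commutative monoids.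
module ℕ-Sum = MonoidSum +-0-commutativeMonoid

count≡sum : ∀ {n} (f : Fin n → Bool) → count f ≡ ℕ-Sum.sum (λ i → b2n (f i))
count≡sum {zero}  f = refl
count≡sum {suc n} f = cong (b2n (f zero) +_) (count≡sum (λ i → f (suc i)))

count-ext : ∀ {n} {f g : Fin n → Bool} → (∀ x → f x ≡ g x) → count f ≡ count g
count-ext {zero}  e = refl
count-ext {suc n} e = cong₂ _+_ (cong b2n (e zero)) (count-ext (λ x → e (suc x)))

count-permute : ∀ {n} (π : Permutation′ n) (f : Fin n → Bool) →
  count (λ x → f (π ⟨$⟩ʳ x)) ≡ count f
count-permute π f = begin
  count (λ x → f (π ⟨$⟩ʳ x))             ≡⟨ count≡sum (λ x → f (π ⟨$⟩ʳ x)) ⟩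
  ℕ-Sum.sum (λ x → b2n (f (π ⟨$⟩ʳ x)))  ≡⟨ sym (ℕ-Sum.sum-permute (λ i → b2n (f i)) π) ⟩
  ℕ-Sum.sum (λ i → b2n (f i))           ≡⟨ sym (count≡sum f) ⟩
  count f                               ∎
  where open ≡-Reasoning

count-involution : ∀ {n} (σ : Fin n → Fin n) → (∀ x → σ (σ x) ≡ x) → (f : Fin n → Bool) →
  count (λ x → f (σ x)) ≡ count f
count-involution σ inv = count-permute (permutation σ σ inv inv)

count-mono : ∀ {n} (f g : Fin n → Bool) → (∀ x → f x ≡ true → g x ≡ true) → count f ≤ count g
count-mono {zero} f g h = z≤n
count-mono {suc n} f g h with f zero | g zero | h zero
... | false | false | _ = count-mono _ _ (λ x → h (suc x))
... | false | true  | _ = ≤-trans (count-mono _ _ (λ x → h (suc x))) (n≤1+n _)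
... | true  | true  | _ = s≤s (count-mono _ _ (λ x → h (suc x)))
... | true  | false | p with p refl
... | ()

-- Squeeze: if every 0 of f is a 0 of g and both have the same number of 1s,
-- then g = f.  This is how a line sum forces unknown entries of a line.
count-squeeze-zeros : ∀ {n} (f g : Fin n → Bool) → count g ≡ count f →
  (∀ x → f x ≡ false → g x ≡ false) → ∀ x → g x ≡ f x
count-squeeze-zeros {zero}  f g c h ()
count-squeeze-zeros {suc n} f g c h x = by-head (f zero) (g zero) refl refl x
  where
  f′ g′ : Fin n → Bool
  f′ i = f (suc i)
  g′ i = g (suc i)
  tail-mono : count g′ ≤ count f′
  tail-mono = count-mono g′ f′ ones
    where
    ones : ∀ y → g (suc y) ≡ true → f (suc y) ≡ true
    ones y gy with f (suc y) in e
    ... | true  = refl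
    ... | false with trans (sym gy) (h (suc y) e)
    ... | ()
  heads : ∀ a b → f zero ≡ a → g zero ≡ b → b2n b + count g′ ≡ b2n a + count f′
  heads a b ea eb = trans (cong (λ z → b2n z + count g′) (sym eb)) (trans c (cong (λ z → b2n z + count f′) ea))
  same-head : ∀ a → f zero ≡ a → g zero ≡ a → ∀ x → g x ≡ f x
  same-head a ea eb zero = trans eb (sym ea)
  same-head a ea eb (suc x) =
    count-squeeze-zeros f′ g′ (+-cancelˡ-≡ (b2n a) _ _ (heads a a ea eb)) (λ y → h (suc y)) x
  by-head : ∀ a b → f zero ≡ a → g zero ≡ b → ∀ x → g x ≡ f x
  by-head false true ea eb x with trans (sym eb) (h zero ea)
  ... | ()
  by-head true false ea eb x = ⊥-elim (<⇒≱ (≤-reflexive (sym (heads true false ea eb))) tail-mono)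
  by-head false false ea eb x = same-head false ea eb x
  by-head true  true  ea eb x = same-head true  ea eb x

count-squeeze-ones : ∀ {n} (f g : Fin n → Bool) → count g ≡ count f →
  (∀ x → f x ≡ true → g x ≡ true) → ∀ x → g x ≡ f x
count-squeeze-ones f g c h x = sym (count-squeeze-zeros g f (sym c) zeros x)
  where
  zeros : ∀ y → g y ≡ false → f y ≡ false
  zeros y gy with f y in e
  ... | false = refl
  ... | true  with trans (sym (h y e)) gy
  ... | ()

count-swap : ∀ {n} (f g : Fin n → Bool) (p q : Fin n) →
  f p ≡ true → f q ≡ false → g p ≡ false → g q ≡ true →
  (∀ x → x ≢ p → x ≢ q → g x ≡ f x) → count g ≡ count f
count-swap f g p q fp fq gp gq others =
  trans (count-ext swapped) (count-permute (transpose p q) f)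
  where
  swapped : ∀ x → g x ≡ f (PermutationComponents.transpose p q x)
  swapped x with x ≟ᶠ p
  ... | yes refl = trans gp (sym fq)
  ... | no x≢p with x ≟ᶠ q
  ... | yes refl = trans gq (sym fp)
  ... | no x≢q = others x x≢p x≢q

count-raise : ∀ {n} (f g : Fin n → Bool) (p : Fin n) → f p ≡ false → g p ≡ true →
  (∀ x → x ≢ p → g x ≡ f x) → count g ≡ suc (count f)
count-raise {suc n} f g zero fp gp others rewrite fp | gp =
  cong suc (count-ext (λ x → others (suc x) (λ ())))
count-raise {suc n} f g (suc p) fp gp others rewrite others zero (λ ()) =
  trans (cong (b2n (f zero) +_) (count-raise (λ i → f (suc i)) (λ i → g (suc i)) p fp gp
          (λ x x≢p → others (suc x) (λ e → x≢p (fsuc-injective e)))))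
        (+-suc _ _)

count-raise₂ : ∀ {n} (f g : Fin n → Bool) (p q : Fin n) → p ≢ q →
  f p ≡ false → f q ≡ false → g p ≡ true → g q ≡ true →
  (∀ x → x ≢ p → x ≢ q → g x ≡ f x) → count g ≡ 2 + count f
count-raise₂ {n} f g p q p≢q fp fq gp gq others =
  trans (count-raise h g q hq gq g≡h) (cong suc (count-raise f h p fp hp h≡f))
  where
  h : Fin n → Bool
  h x with x ≟ᶠ p
  ... | yes _ = true
  ... | no _  = f x
  hp : h p ≡ true
  hp with p ≟ᶠ p
  ... | yes _  = refl
  ... | no p≢p = ⊥-elim (p≢p refl)
  hq : h q ≡ false
  hq with q ≟ᶠ p
  ... | yes q≡p = ⊥-elim (p≢q (sym q≡p))
  ... | no _    = fq
  h≡f : ∀ x → x ≢ p → h x ≡ f x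
  h≡f x x≢p with x ≟ᶠ p
  ... | yes x≡p = ⊥-elim (x≢p x≡p)
  ... | no _    = refl
  g≡h : ∀ x → x ≢ q → g x ≡ h x
  g≡h x x≢q with x ≟ᶠ p
  ... | yes refl = gp
  ... | no x≢p   = others x x≢p x≢q

sizeRows-ext : ∀ {r c} (S S′ : Fin r → Fin c → Bool) → (∀ a → count (S a) ≡ count (S′ a)) →
  sizeRows S ≡ sizeRows S′
sizeRows-ext {zero}  S S′ e = refl
sizeRows-ext {suc r} S S′ e =
  cong₂ _+_ (e zero) (sizeRows-ext (λ i → S (suc i)) (λ i → S′ (suc i)) (λ a → e (suc a)))

sizeRows-raise : ∀ {r c} (S S′ : Fin r → Fin c → Bool) (p : Fin r) (k : ℕ) →
  (∀ a → a ≢ p → count (S′ a) ≡ count (S a)) → count (S′ p) ≡ k + count (S p) →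
  sizeRows S′ ≡ k + sizeRows S
sizeRows-raise {suc r} S S′ zero k others ep =
  trans (cong₂ _+_ ep (sizeRows-ext (λ i → S′ (suc i)) (λ i → S (suc i)) (λ a → others (suc a) (λ ()))))
        (+-assoc k _ _)
sizeRows-raise {suc r} S S′ (suc p) k others ep = begin
  count (S′ zero) + sizeRows (λ i → S′ (suc i))
    ≡⟨ cong₂ _+_ (others zero (λ ()))
         (sizeRows-raise (λ i → S (suc i)) (λ i → S′ (suc i)) p k
           (λ a a≢p → others (suc a) (λ e → a≢p (fsuc-injective e))) ep) ⟩
  count (S zero) + (k + rest)  ≡⟨ sym (+-assoc (count (S zero)) k rest) ⟩
  count (S zero) + k + rest    ≡⟨ cong (_+ rest) (+-comm (count (S zero)) k) ⟩
  k + count (S zero) + rest    ≡⟨ +-assoc k _ rest ⟩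
  k + (count (S zero) + rest)  ∎
  where
  open ≡-Reasoning
  rest : ℕ
  rest = sizeRows (λ i → S (suc i))

sizeRows-raise-lower : ∀ {r c} (S S′ : Fin r → Fin c → Bool) (p₁ p₂ : Fin r) (k₁ k₂ : ℕ) → p₁ ≢ p₂ →
  (∀ a → a ≢ p₁ → a ≢ p₂ → count (S′ a) ≡ count (S a)) →
  count (S′ p₁) ≡ k₁ + count (S p₁) → count (S p₂) ≡ k₂ + count (S′ p₂) →
  sizeRows S′ + k₂ ≡ k₁ + sizeRows S
sizeRows-raise-lower S S′ p₁ p₂ k₁ k₂ p₁≢p₂ others e₁ e₂ =
  trans (+-comm (sizeRows S′) k₂) (trans (sym T-from-S′) T-from-S)
  where
  T : Fin _ → Fin _ → Bool
  T a with a ≟ᶠ p₁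
  ... | yes _ = S′ a
  ... | no _  = S a
  T-p₁ : T p₁ ≡ S′ p₁
  T-p₁ with p₁ ≟ᶠ p₁
  ... | yes _ = refl
  ... | no p₁≢p₁ = ⊥-elim (p₁≢p₁ refl)
  T-other : ∀ a → a ≢ p₁ → T a ≡ S a
  T-other a a≢p₁ with a ≟ᶠ p₁
  ... | yes a≡p₁ = ⊥-elim (a≢p₁ a≡p₁)
  ... | no _ = refl
  T-from-S : sizeRows T ≡ k₁ + sizeRows S
  T-from-S = sizeRows-raise S T p₁ k₁ (λ a a≢p₁ → cong count (T-other a a≢p₁)) (trans (cong count T-p₁) e₁)
  T-from-S′ : sizeRows T ≡ k₂ + sizeRows S′
  T-from-S′ = sizeRows-raise S′ T p₂ k₂ rows (trans (cong count (T-other p₂ (λ e → p₁≢p₂ (sym e)))) e₂)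
    where
    rows : ∀ a → a ≢ p₂ → count (T a) ≡ count (S′ a)
    rows a a≢p₂ with a ≟ᶠ p₁
    ... | yes refl = refl
    ... | no a≢p₁ = sym (others a a≢p₁ a≢p₂)

-- The back set

-- back M consists of the 1s strictly below the diagonal and the 0s strictly
-- above it.  It is the critical set exhibited for every matrix we construct.
back : ∀ {n} → Matrix n → Cells n
back M a b = (M a b ∧ does (toℕ b <? toℕ a)) ∨ (not (M a b) ∧ does (toℕ a <? toℕ b))

back-below : ∀ {n} (M : Matrix n) a b → toℕ b < toℕ a → back M a b ≡ M a b
back-below M a b b<a
  rewrite dec-true (toℕ b <? toℕ a) b<a | dec-false (toℕ a <? toℕ b) (<-asym b<a) with M a b
... | true  = refl
... | false = refl

back-above : ∀ {n} (M : Matrix n) a b → toℕ a < toℕ b → back M a b ≡ not (M a b)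
back-above M a b a<b
  rewrite dec-false (toℕ b <? toℕ a) (<-asym a<b) | dec-true (toℕ a <? toℕ b) a<b with M a b
... | true  = refl
... | false = refl

back-diagonal : ∀ {n} (M : Matrix n) a b → toℕ a ≡ toℕ b → back M a b ≡ false
back-diagonal M a b a≡b
  rewrite dec-false (toℕ b <? toℕ a) (<-irrefl (sym a≡b)) | dec-false (toℕ a <? toℕ b) (<-irrefl a≡b)
  with M a b
... | true  = refl
... | false = refl

back-cells : ∀ {n} (M : Matrix n) a b → back M a b ≡ true →
  (M a b ≡ true × toℕ b < toℕ a) ⊎ (M a b ≡ false × toℕ a < toℕ b)
back-cells M a b e with <-cmp (toℕ b) (toℕ a)
... | tri< b<a _ _ = inj₁ (trans (sym (back-below M a b b<a)) e , b<a)
... | tri≈ _ b≡a _ = clash e (back-diagonal M a b (sym b≡a))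
... | tri> _ _ a<b = inj₂ (not-true (trans (sym (back-above M a b a<b)) e) , a<b)
  where
  not-true : ∀ {v} → not v ≡ true → v ≡ false
  not-true e′ = trans (sym (not-involutive _)) (cong not e′)

back-cong : ∀ {n} (M M′ : Matrix n) a b → M′ a b ≡ M a b → back M′ a b ≡ back M a b
back-cong M M′ a b e = cong (λ v → (v ∧ _) ∨ (not v ∧ _)) e

-- Lines are recovered in the order 0, 1, 2, …: at index a, every
-- off-diagonal 0 of row a and every off-diagonal 1 of column a is known, either
-- from an earlier line or from back M; the line sum then squeezes the whole row
-- (resp. column), and the diagonal entry passes from one to the other.
module Reconstruction {n} (M M′ : Matrix n)
  (same-rows : ∀ i → count (M′ i) ≡ count (M i))
  (same-cols : ∀ j → count (λ i → M′ i j) ≡ count (λ i → M i j))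
  (agree : Contains M M′ (back M)) where

  LinesAgree : Fin n → Set
  LinesAgree a = (∀ b → M′ a b ≡ M a b) × (∀ b → M′ b a ≡ M b a)

  module AtIndex (a : Fin n) (earlier : ∀ b → toℕ b < toℕ a → LinesAgree b) where

    row-zeros : ∀ b → b ≢ a → M a b ≡ false → M′ a b ≡ false
    row-zeros b b≢a mb with <-cmp (toℕ b) (toℕ a)
    ... | tri< b<a _ _ = trans (proj₂ (earlier b b<a) a) mb
    ... | tri≈ _ b≡a _ = ⊥-elim (b≢a (toℕ-injective b≡a))
    ... | tri> _ _ a<b = trans (agree a b (trans (back-above M a b a<b) (cong not mb))) mb

    col-ones : ∀ b → b ≢ a → M b a ≡ true → M′ b a ≡ true
    col-ones b b≢a mb with <-cmp (toℕ b) (toℕ a)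
    ... | tri< b<a _ _ = trans (proj₁ (earlier b b<a) a) mb
    ... | tri≈ _ b≡a _ = ⊥-elim (b≢a (toℕ-injective b≡a))
    ... | tri> _ _ a<b = trans (agree b a (trans (back-below M b a a<b) mb)) mb

    row : (M a a ≡ false → M′ a a ≡ false) → ∀ b → M′ a b ≡ M a b
    row diagonal = count-squeeze-zeros (M a) (M′ a) (same-rows a) zeros
      where
      zeros : ∀ b → M a b ≡ false → M′ a b ≡ false
      zeros b mb with b ≟ᶠ a
      ... | yes refl = diagonal mb
      ... | no b≢a   = row-zeros b b≢a mb

    col : (M a a ≡ true → M′ a a ≡ true) → ∀ b → M′ b a ≡ M b a
    col diagonal = count-squeeze-ones (λ i → M i a) (λ i → M′ i a) (same-cols a) ones
      where
      ones : ∀ b → M b a ≡ true → M′ b a ≡ true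
      ones b mb with b ≟ᶠ a
      ... | yes refl = diagonal mb
      ... | no b≢a   = col-ones b b≢a mb

    -- if M a a = 1 the row comes first, otherwise the column
    lines : ∀ v → M a a ≡ v → LinesAgree a
    lines true e = row-a , col (λ _ → trans (row-a a) e)
      where
      row-a : ∀ b → M′ a b ≡ M a b
      row-a = row (λ e′ → clash e e′)
    lines false e = row (λ _ → trans (col-a a) e) , col-a
      where
      col-a : ∀ b → M′ b a ≡ M b a
      col-a = col (λ e′ → clash e′ e)

  lines-below : ∀ t a → toℕ a < t → LinesAgree a
  lines-below (suc t) a a<t with <-cmp (toℕ a) t
  ... | tri< a<t′ _ _ = lines-below t a a<t′
  ... | tri≈ _ refl _ = AtIndex.lines a (lines-below t) (M a a) refl
  ... | tri> _ _ t<a  = ⊥-elim (<⇒≱ a<t t<a)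

  agrees : ∀ i j → M′ i j ≡ M i j
  agrees i j = proj₁ (lines-below (suc (toℕ i)) i ≤-refl) j

back-defining : ∀ m (M : Matrix (2 * m)) → InΛ (2 * m) m M → IsDefining m M (back M)
back-defining m M (rows , cols) = (rows , cols) , λ M′ (rows′ , cols′) agree →
  Reconstruction.agrees M M′ (λ i → trans (rows′ i) (sym (rows i)))
                             (λ j → trans (cols′ j) (sym (cols j))) agree

-- Switching

Switchable : ∀ {n} → (Fin n → Bool) → (Fin n → Set) → Set
Switchable {n} f Z = (∀ x → ¬ Z x) ⊎
  (Σ (Fin n) λ p → Σ (Fin n) λ q →
     f p ≡ true × f q ≡ false × Z p × Z q × (∀ x → Z x → x ≡ p ⊎ x ≡ q))

switch-line-count : ∀ {n} (f : Fin n → Bool) (Z : Fin n → Set) (Z? : ∀ x → Dec (Z x)) →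
  Switchable f Z → count (λ x → does (Z? x) xor f x) ≡ count f
switch-line-count f Z Z? (inj₁ none) = count-ext (λ x → cong (_xor f x) (dec-false (Z? x) (none x)))
switch-line-count f Z Z? (inj₂ (p , q , fp , fq , Zp , Zq , only)) =
  count-swap f (λ x → does (Z? x) xor f x) p q fp fq
    (trans (cong (_xor f p) (dec-true (Z? p) Zp)) (cong not fp))
    (trans (cong (_xor f q) (dec-true (Z? q) Zq)) (cong not fq))
    (λ x x≢p x≢q → cong (_xor f x) (dec-false (Z? x) (outside x≢p x≢q ∘ only x)))
  where
  outside : ∀ {x} → x ≢ p → x ≢ q → ¬ (x ≡ p ⊎ x ≡ q)
  outside x≢p x≢q (inj₁ e) = x≢p e
  outside x≢p x≢q (inj₂ e) = x≢q e

switch : ∀ {n} (Z : Fin n → Fin n → Set) → (∀ a b → Dec (Z a b)) → Matrix n → Matrix n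
switch Z Z? M a b = does (Z? a b) xor M a b

switch-inside : ∀ {n} (Z : Fin n → Fin n → Set) (Z? : ∀ a b → Dec (Z a b)) (M : Matrix n) a b →
  Z a b → switch Z Z? M a b ≡ not (M a b)
switch-inside Z Z? M a b z = cong (_xor M a b) (dec-true (Z? a b) z)

switch-outside : ∀ {n} (Z : Fin n → Fin n → Set) (Z? : ∀ a b → Dec (Z a b)) (M : Matrix n) a b →
  ¬ Z a b → switch Z Z? M a b ≡ M a b
switch-outside Z Z? M a b ¬z = cong (_xor M a b) (dec-false (Z? a b) ¬z)

switch-Λ : ∀ {n x} (Z : Fin n → Fin n → Set) (Z? : ∀ a b → Dec (Z a b)) (M : Matrix n) → InΛ n x M →
  (∀ a → Switchable (M a) (Z a)) → (∀ b → Switchable (λ a → M a b) (λ a → Z a b)) →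
  InΛ n x (switch Z Z? M)
switch-Λ Z Z? M (rows , cols) rows-ok cols-ok =
  (λ a → trans (switch-line-count (M a) (Z a) (Z? a) (rows-ok a)) (rows a)) ,
  (λ b → trans (switch-line-count (λ a → M a b) (λ a → Z a b) (λ a → Z? a b) (cols-ok b)) (cols b))

-- Criticality

Essential : ∀ m (M : Matrix (2 * m)) → Fin (2 * m) → Fin (2 * m) → Set
Essential m M i j = Σ (Matrix (2 * m)) λ M″ → InΛ (2 * m) m M″ ×
  (∀ a b → back M a b ≡ true → ¬ (a ≡ i × b ≡ j) → M″ a b ≡ M a b) × (M″ i j ≢ M i j)

critical-if-essential : ∀ m (M : Matrix (2 * m)) → InΛ (2 * m) m M →
  (∀ i j → back M i j ≡ true → Essential m M i j) → IsCritical m M (back M)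
critical-if-essential m M Λ essential = back-defining m M Λ , minimal
  where
  minimal : ∀ S′ → ProperSubset S′ (back M) → ¬ IsDefining m M S′
  minimal S′ (S′⊆back , i , j , back-ij , S′-ij) (_ , unique) with essential i j back-ij
  ... | M″ , Λ″ , agrees , differs = differs (unique M″ Λ″ agrees-on-S′ i j)
    where
    not-ij : ∀ a b → S′ a b ≡ true → ¬ (a ≡ i × b ≡ j)
    not-ij a b S′-ab (refl , refl) = clash S′-ab S′-ij
    agrees-on-S′ : Contains M M″ S′
    agrees-on-S′ a b S′-ab = agrees a b (S′⊆back a b S′-ab) (not-ij a b S′-ab)

essential-by-switching : ∀ m (M : Matrix (2 * m)) → InΛ (2 * m) m M → ∀ i j →
  (Z : Fin (2 * m) → Fin (2 * m) → Set) (Z? : ∀ a b → Dec (Z a b)) →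
  (∀ a → Switchable (M a) (Z a)) → (∀ b → Switchable (λ a → M a b) (λ a → Z a b)) →
  Z i j → (∀ a b → back M a b ≡ true → Z a b → a ≡ i × b ≡ j) →
  Essential m M i j
essential-by-switching m M Λ i j Z Z? rows-ok cols-ok Z-ij only-ij =
  switch Z Z? M , switch-Λ Z Z? M Λ rows-ok cols-ok , agrees , differs
  where
  agrees : ∀ a b → back M a b ≡ true → ¬ (a ≡ i × b ≡ j) → switch Z Z? M a b ≡ M a b
  agrees a b back-ab ab≢ij = switch-outside Z Z? M a b (λ z → ab≢ij (only-ij a b back-ab z))
  differs : switch Z Z? M i j ≢ M i j
  differs e with M i j | trans (sym (switch-inside Z Z? M i j Z-ij)) e
  ... | true  | ()
  ... | false | ()

predecessor : ∀ {n} (t : Fin n) → 0 < toℕ t → Σ (Fin n) λ s → toℕ t ≡ suc (toℕ s)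
predecessor (suc s) _ = inject₁ s , cong suc (sym (toℕ-inject₁ s))

DiagonalOnes : ∀ {n} → Matrix n → ℕ → ℕ → Set
DiagonalOnes M lo hi = ∀ t → lo ≤ toℕ t → toℕ t < hi → M t t ≡ true

SubdiagonalZeros : ∀ {n} → Matrix n → ℕ → ℕ → Set
SubdiagonalZeros M lo hi = ∀ t s → toℕ t ≡ suc (toℕ s) → lo ≤ toℕ s → toℕ s < hi → M t s ≡ false

-- Let a < b be rows and c a column outside [a, b).  The
-- staircase consists of the diagonal cells (t,t) and the subdiagonal cells
-- (t+1,t) for a ≤ t < b, closed up by the two cells (a,c) and (b,c).  When M
-- is 1 on the diagonal cells and at (b,c) and 0 on the subdiagonal cells and
-- at (a,c), it is switchable in every row and every column.
module Staircase {n} (M : Matrix n) (a b c : Fin n) (a<b : toℕ a < toℕ b)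
  (c-outside : toℕ c < toℕ a ⊎ toℕ b ≤ toℕ c)
  (M-ac : M a c ≡ false) (M-bc : M b c ≡ true)
  (diagonal : DiagonalOnes M (toℕ a) (toℕ b))
  (subdiagonal : SubdiagonalZeros M (toℕ a) (toℕ b)) where

  InRange : Fin n → Set
  InRange t = toℕ a ≤ toℕ t × toℕ t < toℕ b

  Diagonal Subdiagonal Closing Steps : Fin n → Fin n → Set
  Diagonal x y    = toℕ x ≡ toℕ y × InRange y
  Subdiagonal x y = toℕ x ≡ suc (toℕ y) × InRange y
  Closing x y     = (x ≡ a ⊎ x ≡ b) × y ≡ c
  Steps x y       = Diagonal x y ⊎ Subdiagonal x y ⊎ Closing x y

  InRange? : ∀ t → Dec (InRange t)
  InRange? t = (toℕ a ≤? toℕ t) ×-dec (toℕ t <? toℕ b)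

  Steps? : ∀ x y → Dec (Steps x y)
  Steps? x y = ((toℕ x ≟ toℕ y) ×-dec InRange? y) ⊎-dec
               (((toℕ x ≟ suc (toℕ y)) ×-dec InRange? y) ⊎-dec
                (((x ≟ᶠ a) ⊎-dec (x ≟ᶠ b)) ×-dec (y ≟ᶠ c)))

  c∉range : ¬ InRange c
  c∉range (a≤c , c<b) = [ (λ c<a → <⇒≱ c<a a≤c) , (λ b≤c → <⇒≱ c<b b≤c) ]′ c-outside

  below : ∀ t → InRange t → Σ (Fin n) λ s → toℕ s ≡ suc (toℕ t)
  below t (_ , t<b) = fromℕ< (≤-trans (s≤s t<b) (toℕ<n b)) , toℕ-fromℕ< _

  left : ∀ t → toℕ a < toℕ t → Σ (Fin n) λ s → toℕ t ≡ suc (toℕ s)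
  left t a<t = predecessor t (≤-trans (s≤s z≤n) a<t)

  rows : ∀ x → Switchable (M x) (Steps x)
  rows x with x ≟ᶠ a
  ... | yes refl = inj₂ (a , c , diagonal a ≤-refl a<b , M-ac ,
                         inj₁ (refl , ≤-refl , a<b) , inj₂ (inj₂ (inj₁ refl , refl)) , only)
    where
    only : ∀ y → Steps a y → y ≡ a ⊎ y ≡ c
    only y (inj₁ (e , _))              = inj₁ (toℕ-injective (sym e))
    only y (inj₂ (inj₁ (e , a≤y , _))) = ⊥-elim (<-irrefl e (≤-trans (s≤s a≤y) ≤-refl))
    only y (inj₂ (inj₂ (_ , y≡c)))     = inj₂ y≡c
  ... | no x≢a with x ≟ᶠ b
  ... | yes refl = inj₂ (c , p , M-bc , subdiagonal b p ep a≤p p<b ,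
                         inj₂ (inj₂ (inj₂ refl , refl)) , inj₂ (inj₁ (ep , a≤p , p<b)) , only)
    where
    p : Fin n
    p = proj₁ (left b a<b)
    ep : toℕ b ≡ suc (toℕ p)
    ep = proj₂ (left b a<b)
    p<b : toℕ p < toℕ b
    p<b = ≤-reflexive (sym ep)
    a≤p : toℕ a ≤ toℕ p
    a≤p = ≤-pred (≤-trans a<b (≤-reflexive ep))
    only : ∀ y → Steps b y → y ≡ c ⊎ y ≡ p
    only y (inj₁ (e , _ , y<b))    = ⊥-elim (<-irrefl (sym e) y<b)
    only y (inj₂ (inj₁ (e , _)))   = inj₂ (toℕ-injective (suc-injective (trans (sym e) ep)))
    only y (inj₂ (inj₂ (_ , y≡c))) = inj₁ y≡c
  ... | no x≢b with (toℕ a <? toℕ x) ×-dec (toℕ x <? toℕ b)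
  ... | yes (a<x , x<b) = inj₂ (x , p , diagonal x (<⇒≤ a<x) x<b , subdiagonal x p ep a≤p p<b ,
                                  inj₁ (refl , <⇒≤ a<x , x<b) , inj₂ (inj₁ (ep , a≤p , p<b)) , only)
    where
    p : Fin n
    p = proj₁ (left x a<x)
    ep : toℕ x ≡ suc (toℕ p)
    ep = proj₂ (left x a<x)
    p<b : toℕ p < toℕ b
    p<b = <-trans (≤-reflexive (sym ep)) x<b
    a≤p : toℕ a ≤ toℕ p
    a≤p = ≤-pred (≤-trans a<x (≤-reflexive ep))
    only : ∀ y → Steps x y → y ≡ x ⊎ y ≡ p
    only y (inj₁ (e , _))                  = inj₁ (toℕ-injective (sym e))
    only y (inj₂ (inj₁ (e , _)))           = inj₂ (toℕ-injective (suc-injective (trans (sym e) ep)))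
    only y (inj₂ (inj₂ (inj₁ x≡a , _)))    = ⊥-elim (x≢a x≡a)
    only y (inj₂ (inj₂ (inj₂ x≡b , _)))    = ⊥-elim (x≢b x≡b)
  ... | no ¬between = inj₁ none
    where
    none : ∀ y → ¬ Steps x y
    none y (inj₁ (e , a≤y , y<b)) =
      ¬between (≤∧≢⇒< (≤-trans a≤y (≤-reflexive (sym e))) (λ a≡x → x≢a (toℕ-injective (sym a≡x))) ,
                ≤-trans (s≤s (≤-reflexive e)) y<b)
    none y (inj₂ (inj₁ (e , a≤y , y<b))) =
      ¬between (≤-trans (s≤s a≤y) (≤-reflexive (sym e)) ,
                ≤∧≢⇒< (≤-trans (≤-reflexive e) y<b) (λ x≡b → x≢b (toℕ-injective x≡b)))
    none y (inj₂ (inj₂ (inj₁ x≡a , _))) = x≢a x≡a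
    none y (inj₂ (inj₂ (inj₂ x≡b , _))) = x≢b x≡b

  cols : ∀ y → Switchable (λ x → M x y) (λ x → Steps x y)
  cols y with y ≟ᶠ c
  ... | yes refl = inj₂ (b , a , M-bc , M-ac ,
                         inj₂ (inj₂ (inj₂ refl , refl)) , inj₂ (inj₂ (inj₁ refl , refl)) , only)
    where
    only : ∀ x → Steps x c → x ≡ b ⊎ x ≡ a
    only x (inj₁ (_ , r))               = ⊥-elim (c∉range r)
    only x (inj₂ (inj₁ (_ , r)))        = ⊥-elim (c∉range r)
    only x (inj₂ (inj₂ (inj₁ x≡a , _))) = inj₂ x≡a
    only x (inj₂ (inj₂ (inj₂ x≡b , _))) = inj₁ x≡b
  ... | no y≢c with InRange? y
  ... | yes r@(a≤y , y<b) = inj₂ (y , s , diagonal y a≤y y<b , subdiagonal s y es a≤y y<b ,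
                                  inj₁ (refl , r) , inj₂ (inj₁ (es , r)) , only)
    where
    s : Fin n
    s = proj₁ (below y r)
    es : toℕ s ≡ suc (toℕ y)
    es = proj₂ (below y r)
    only : ∀ x → Steps x y → x ≡ y ⊎ x ≡ s
    only x (inj₁ (e , _))          = inj₁ (toℕ-injective e)
    only x (inj₂ (inj₁ (e , _)))   = inj₂ (toℕ-injective (trans e (sym es)))
    only x (inj₂ (inj₂ (_ , y≡c))) = ⊥-elim (y≢c y≡c)
  ... | no ¬r = inj₁ none
    where
    none : ∀ x → ¬ Steps x y
    none x (inj₁ (_ , r))          = ¬r r
    none x (inj₂ (inj₁ (_ , r)))   = ¬r r
    none x (inj₂ (inj₂ (_ , y≡c))) = y≢c y≡c

  back-on-steps : ∀ x y → back M x y ≡ true → Steps x y →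
    (toℕ c < toℕ a × x ≡ b × y ≡ c) ⊎ (toℕ b ≤ toℕ c × x ≡ a × y ≡ c)
  back-on-steps x y in-back (inj₁ (e , _)) = clash in-back (back-diagonal M x y e)
  back-on-steps x y in-back (inj₂ (inj₁ (e , a≤y , y<b))) =
    clash in-back (trans (back-below M x y (≤-reflexive (sym e))) (subdiagonal x y e a≤y y<b))
  back-on-steps x y in-back (inj₂ (inj₂ (inj₁ refl , refl))) = closing-a c-outside
    where
    closing-a : toℕ c < toℕ a ⊎ toℕ b ≤ toℕ c →
                (toℕ c < toℕ a × a ≡ b × c ≡ c) ⊎ (toℕ b ≤ toℕ c × a ≡ a × c ≡ c)
    closing-a (inj₁ c<a) = clash in-back (trans (back-below M a c c<a) M-ac)
    closing-a (inj₂ b≤c) = inj₂ (b≤c , refl , refl)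
  back-on-steps x y in-back (inj₂ (inj₂ (inj₂ refl , refl))) = closing-b c-outside
    where
    closing-b : toℕ c < toℕ a ⊎ toℕ b ≤ toℕ c →
                (toℕ c < toℕ a × b ≡ b × c ≡ c) ⊎ (toℕ b ≤ toℕ c × b ≡ a × c ≡ c)
    closing-b (inj₁ c<a) = inj₁ (c<a , refl , refl)
    closing-b (inj₂ b≤c) with m≤n⇒m<n∨m≡n b≤c
    ... | inj₁ b<c = clash in-back (trans (back-above M b c b<c) (cong not M-bc))
    ... | inj₂ b≡c = clash in-back (back-diagonal M b c b≡c)

staircase-essential-below : ∀ m (M : Matrix (2 * m)) → InΛ (2 * m) m M → (a b c : Fin (2 * m)) →
  toℕ a < toℕ b → toℕ c < toℕ a → M a c ≡ false → M b c ≡ true →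
  DiagonalOnes M (toℕ a) (toℕ b) → SubdiagonalZeros M (toℕ a) (toℕ b) → Essential m M b c
staircase-essential-below m M Λ a b c a<b c<a M-ac M-bc diagonal subdiagonal =
  essential-by-switching m M Λ b c Steps Steps? rows cols (inj₂ (inj₂ (inj₂ refl , refl))) only
  where
  open Staircase M a b c a<b (inj₁ c<a) M-ac M-bc diagonal subdiagonal
  only : ∀ x y → back M x y ≡ true → Steps x y → x ≡ b × y ≡ c
  only x y in-back steps with back-on-steps x y in-back steps
  ... | inj₁ (_ , x≡b , y≡c) = x≡b , y≡c
  ... | inj₂ (b≤c , _)       = ⊥-elim (<⇒≱ (<-trans c<a a<b) b≤c)

staircase-essential-above : ∀ m (M : Matrix (2 * m)) → InΛ (2 * m) m M → (a b c : Fin (2 * m)) →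
  toℕ a < toℕ b → toℕ b ≤ toℕ c → M a c ≡ false → M b c ≡ true →
  DiagonalOnes M (toℕ a) (toℕ b) → SubdiagonalZeros M (toℕ a) (toℕ b) → Essential m M a c
staircase-essential-above m M Λ a b c a<b b≤c M-ac M-bc diagonal subdiagonal =
  essential-by-switching m M Λ a c Steps Steps? rows cols (inj₂ (inj₂ (inj₁ refl , refl))) only
  where
  open Staircase M a b c a<b (inj₂ b≤c) M-ac M-bc diagonal subdiagonal
  only : ∀ x y → back M x y ≡ true → Steps x y → x ≡ a × y ≡ c
  only x y in-back steps with back-on-steps x y in-back steps
  ... | inj₁ (c<a , _)       = ⊥-elim (<⇒≱ (<-trans c<a a<b) b≤c)
  ... | inj₂ (_ , x≡a , y≡c) = x≡a , y≡c

record Shaped {n} (M : Matrix n) : Set where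
  field
    subdiagonal-zero : ∀ t s → toℕ t ≡ suc (toℕ s) → M t s ≡ false
    diagonal-one     : ∀ t → suc (toℕ t) < n → M t t ≡ true
    last-diagonal    : ∀ j → M j j ≡ false → Σ (Fin n) λ p → suc (toℕ p) ≡ toℕ j × M p j ≡ true

-- For shaped matrices the back set is critical: every cell of it closes a
-- staircase.
back-critical : ∀ m (M : Matrix (2 * m)) → InΛ (2 * m) m M → Shaped M → IsCritical m M (back M)
back-critical m M Λ shaped = critical-if-essential m M Λ essential
  where
  open Shaped shaped
  diagonal : ∀ lo (b : Fin (2 * m)) → DiagonalOnes M lo (toℕ b)
  diagonal lo b t _ t<b = diagonal-one t (≤-trans (s≤s t<b) (toℕ<n b))
  subdiagonal : ∀ lo hi → SubdiagonalZeros M lo hi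
  subdiagonal lo hi t s e _ _ = subdiagonal-zero t s e
  essential : ∀ i j → back M i j ≡ true → Essential m M i j
  essential i j in-back with back-cells M i j in-back
  ... | inj₁ (M-ij , j<i) =
    staircase-essential-below m M Λ a i j a<i (≤-reflexive (sym ea)) (subdiagonal-zero a j ea) M-ij
      (diagonal (toℕ a) i) (subdiagonal (toℕ a) (toℕ i))
    where
    a : Fin (2 * m)
    a = fromℕ< (≤-trans (s≤s j<i) (toℕ<n i))
    ea : toℕ a ≡ suc (toℕ j)
    ea = toℕ-fromℕ< _
    -- (j+1, j) is subdiagonal, hence a 0, so it is not (i, j)
    a<i : toℕ a < toℕ i
    a<i with m≤n⇒m<n∨m≡n (≤-trans (≤-reflexive ea) j<i)
    ... | inj₁ a<i = a<i
    ... | inj₂ a≡i = clash M-ij (subdiagonal-zero i j (trans (sym a≡i) ea))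
  ... | inj₂ (M-ij , i<j) with M j j in M-jj
  ... | true  = staircase-essential-above m M Λ i j j i<j ≤-refl M-ij M-jj
                  (diagonal (toℕ i) j) (subdiagonal (toℕ i) (toℕ j))
  ... | false with last-diagonal j M-jj
  ... | p , ep , M-pj = staircase-essential-above m M Λ i p j i<p (≤-trans (n≤1+n _) (≤-reflexive ep)) M-ij M-pj
                          (diagonal (toℕ i) p) (subdiagonal (toℕ i) (toℕ p))
    where
    -- i ≤ p as i < j = p + 1, and i ≠ p since M i j = 0 while M p j = 1
    i<p : toℕ i < toℕ p
    i<p with m≤n⇒m<n∨m≡n (≤-pred (≤-trans i<j (≤-reflexive (sym ep))))
    ... | inj₁ i<p = i<p
    ... | inj₂ i≡p = clash (trans (cong (λ x → M x j) (toℕ-injective i≡p)) M-pj) M-ij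

-- Circulant matrices

-- offsetℕ n a b is (a − b) mod n for a, b < n.
offsetℕ : ℕ → ℕ → ℕ → ℕ
offsetℕ n a b with b ≤? a
... | yes _ = a ∸ b
... | no _  = (n ∸ b) + a

offsetℕ-≤ : ∀ n a b → b ≤ a → offsetℕ n a b ≡ a ∸ b
offsetℕ-≤ n a b b≤a with b ≤? a
... | yes _   = refl
... | no b≰a = ⊥-elim (b≰a b≤a)

offsetℕ-> : ∀ n a b → a < b → offsetℕ n a b ≡ (n ∸ b) + a
offsetℕ-> n a b a<b with b ≤? a
... | yes b≤a = ⊥-elim (<⇒≱ a<b b≤a)
... | no _    = refl

offsetℕ<n : ∀ n a b → a < n → b < n → offsetℕ n a b < n
offsetℕ<n n a b a<n b<n with b ≤? a
... | yes _   = ≤-trans (s≤s (m∸n≤m a b)) a<n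
... | no b≰a = begin-strict
    (n ∸ b) + a <⟨ +-monoʳ-< (n ∸ b) (≰⇒> b≰a) ⟩
    (n ∸ b) + b ≡⟨ m∸n+n≡m (<⇒≤ b<n) ⟩
    n           ∎
  where open ≤-Reasoning

offsetℕ-self : ∀ n a → offsetℕ n a a ≡ 0
offsetℕ-self n a = trans (offsetℕ-≤ n a a ≤-refl) (n∸n≡0 a)

offsetℕ-involutive : ∀ n a b → a < n → b < n → offsetℕ n a (offsetℕ n a b) ≡ b
offsetℕ-involutive n a b a<n b<n with b ≤? a
... | yes b≤a = trans (offsetℕ-≤ n a (a ∸ b) (m∸n≤m a b)) (m∸[m∸n]≡n b≤a)
... | no b≰a  = trans (offsetℕ-> n a (x + a) a<x+a) (begin
    (n ∸ (x + a)) + a       ≡⟨ cong (λ z → (z ∸ (x + a)) + a) (trans (sym (m+[n∸m]≡n (<⇒≤ b<n))) (+-comm b x)) ⟩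
    ((x + b) ∸ (x + a)) + a ≡⟨ cong (_+ a) ([m+n]∸[m+o]≡n∸o x b a) ⟩
    (b ∸ a) + a             ≡⟨ m∸n+n≡m (<⇒≤ (≰⇒> b≰a)) ⟩
    b                       ∎)
  where
  open ≡-Reasoning
  x : ℕ
  x = n ∸ b
  a<x+a : a < x + a
  a<x+a = +-monoˡ-≤ a (m<n⇒0<n∸m b<n)

offsetℕ-antisymmetric : ∀ n a b → a < n → b < n → offsetℕ n a b ≡ offsetℕ n 0 (offsetℕ n b a)
offsetℕ-antisymmetric n a b a<n b<n with <-cmp a b
... | tri< a<b _ _ = begin
    offsetℕ n a b                   ≡⟨ offsetℕ-> n a b a<b ⟩
    (n ∸ b) + a                     ≡⟨ sym arithmetic ⟩
    (n ∸ (b ∸ a)) + 0               ≡⟨ sym (offsetℕ-> n 0 (b ∸ a) (m<n⇒0<n∸m a<b)) ⟩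
    offsetℕ n 0 (b ∸ a)             ≡⟨ cong (offsetℕ n 0) (sym (offsetℕ-≤ n b a (<⇒≤ a<b))) ⟩
    offsetℕ n 0 (offsetℕ n b a)     ∎
  where
  open ≡-Reasoning
  arithmetic : (n ∸ (b ∸ a)) + 0 ≡ (n ∸ b) + a
  arithmetic = begin
    (n ∸ (b ∸ a)) + 0           ≡⟨ +-identityʳ _ ⟩
    n ∸ (b ∸ a)                 ≡⟨ cong (_∸ (b ∸ a)) (sym (m∸n+n≡m {n} {b} (<⇒≤ b<n))) ⟩
    ((n ∸ b) + b) ∸ (b ∸ a)     ≡⟨ +-∸-assoc (n ∸ b) (m∸n≤m b a) ⟩
    (n ∸ b) + (b ∸ (b ∸ a))     ≡⟨ cong ((n ∸ b) +_) (m∸[m∸n]≡n (<⇒≤ a<b)) ⟩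
    (n ∸ b) + a                 ∎
... | tri≈ _ refl _ = trans (offsetℕ-self n a)
    (trans (sym (offsetℕ-≤ n 0 0 z≤n)) (cong (offsetℕ n 0) (sym (offsetℕ-self n a))))
... | tri> _ _ b<a = begin
    offsetℕ n a b                   ≡⟨ offsetℕ-≤ n a b (<⇒≤ b<a) ⟩
    a ∸ b                           ≡⟨ sym arithmetic ⟩
    (n ∸ ((n ∸ a) + b)) + 0         ≡⟨ sym (offsetℕ-> n 0 ((n ∸ a) + b) (≤-trans (m<n⇒0<n∸m a<n) (m≤m+n _ b))) ⟩
    offsetℕ n 0 ((n ∸ a) + b)       ≡⟨ cong (offsetℕ n 0) (sym (offsetℕ-> n b a b<a)) ⟩
    offsetℕ n 0 (offsetℕ n b a)     ∎
  where
  open ≡-Reasoning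
  arithmetic : (n ∸ ((n ∸ a) + b)) + 0 ≡ a ∸ b
  arithmetic = begin
    (n ∸ ((n ∸ a) + b)) + 0     ≡⟨ +-identityʳ _ ⟩
    n ∸ ((n ∸ a) + b)           ≡⟨ sym (∸-+-assoc n (n ∸ a) b) ⟩
    (n ∸ (n ∸ a)) ∸ b           ≡⟨ cong (_∸ b) (m∸[m∸n]≡n (<⇒≤ a<n)) ⟩
    a ∸ b                       ∎

module _ {n : ℕ} where

  offset : Fin n → Fin n → Fin n
  offset a b = fromℕ< (offsetℕ<n n (toℕ a) (toℕ b) (toℕ<n a) (toℕ<n b))

  toℕ-offset : ∀ a b → toℕ (offset a b) ≡ offsetℕ n (toℕ a) (toℕ b)
  toℕ-offset a b = toℕ-fromℕ< _

  offset-involutive : ∀ a b → offset a (offset a b) ≡ b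
  offset-involutive a b = toℕ-injective (begin
    toℕ (offset a (offset a b))            ≡⟨ toℕ-offset a (offset a b) ⟩
    offsetℕ n (toℕ a) (toℕ (offset a b))   ≡⟨ cong (offsetℕ n (toℕ a)) (toℕ-offset a b) ⟩
    offsetℕ n (toℕ a) (offsetℕ n (toℕ a) (toℕ b))
      ≡⟨ offsetℕ-involutive n (toℕ a) (toℕ b) (toℕ<n a) (toℕ<n b) ⟩
    toℕ b                                  ∎)
    where open ≡-Reasoning

  circulant : (Fin n → Bool) → Matrix n
  circulant D a b = D (offset a b)

  -- Every row and every column of a circulant is a permutation of D.
  circulant-Λ : ∀ {x} (D : Fin n → Bool) → count D ≡ x → InΛ n x (circulant D)
  circulant-Λ {x} D count-D = (λ a → trans (count-involution (offset a) (offset-involutive a) D) count-D) , cols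
    where
    cols : ∀ b → count (λ a → D (offset a b)) ≡ x
    cols b = begin
      count (λ a → D (offset a b))               ≡⟨ count-ext reflected ⟩
      count (λ a → D (offset z (offset b a)))    ≡⟨ count-involution (offset b) (offset-involutive b) _ ⟩
      count (λ c → D (offset z c))               ≡⟨ count-involution (offset z) (offset-involutive z) D ⟩
      count D                                    ≡⟨ count-D ⟩
      x                                          ∎
      where
      open ≡-Reasoning
      z = offset b b
      z≡0 : toℕ z ≡ 0
      z≡0 = trans (toℕ-offset b b) (offsetℕ-self n (toℕ b))
      reflected : ∀ a → D (offset a b) ≡ D (offset z (offset b a))
      reflected a = cong D (toℕ-injective (begin
        toℕ (offset a b)                               ≡⟨ toℕ-offset a b ⟩
        offsetℕ n (toℕ a) (toℕ b)                      ≡⟨ offsetℕ-antisymmetric n (toℕ a) (toℕ b) (toℕ<n a) (toℕ<n b) ⟩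
        offsetℕ n 0 (offsetℕ n (toℕ b) (toℕ a))        ≡⟨ cong₂ (offsetℕ n) (sym z≡0) (sym (toℕ-offset b a)) ⟩
        offsetℕ n (toℕ z) (toℕ (offset b a))           ≡⟨ sym (toℕ-offset z (offset b a)) ⟩
        toℕ (offset z (offset b a))                    ∎))

-- In row a, the cell at offset d (that is,
-- column a − d) carrying the value v lies in the back set iff 1 ≤ d ≤ a and
-- v = 1 (the column is left of the diagonal), or a < d and v = 0 (it is right
-- of the diagonal, after wrapping around).
inBack : ℕ → ℕ → Bool → Bool
inBack a d v = (does (d ≤? a) ∧ does (1 ≤? d) ∧ v) ∨ (does (a <? d) ∧ not v)

inBack-left : ∀ a d v → 1 ≤ d → d ≤ a → inBack a d v ≡ v
inBack-left a d v 1≤d d≤a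
  rewrite dec-true (d ≤? a) d≤a | dec-true (1 ≤? d) 1≤d | dec-false (a <? d) (≤⇒≯ d≤a) with v
... | true  = refl
... | false = refl

inBack-diagonal : ∀ a v → inBack a 0 v ≡ false
inBack-diagonal a v rewrite dec-false (a <? 0) (λ ()) with 0 ≤? a
... | yes _ = refl
... | no _  = refl

inBack-right : ∀ a d v → a < d → inBack a d v ≡ not v
inBack-right a d v a<d rewrite dec-false (d ≤? a) (<⇒≱ a<d) | dec-true (a <? d) a<d = refl

backRow : ∀ {n} → (Fin n → Bool) → Fin n → Fin n → Bool
backRow D a d = inBack (toℕ a) (toℕ d) (D d)

module _ {n : ℕ} where

  back-circulant : ∀ (D : Fin n → Bool) a b → back (circulant D) a b ≡ backRow D a (offset a b)
  back-circulant D a b with <-cmp (toℕ b) (toℕ a)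
  ... | tri< b<a _ _ = trans (back-below (circulant D) a b b<a) (sym (inBack-left (toℕ a) (toℕ (offset a b)) _
          (≤-trans (m<n⇒0<n∸m b<a) (≤-reflexive (sym e))) (≤-trans (≤-reflexive e) (m∸n≤m (toℕ a) (toℕ b)))))
    where
    e : toℕ (offset a b) ≡ toℕ a ∸ toℕ b
    e = trans (toℕ-offset a b) (offsetℕ-≤ n (toℕ a) (toℕ b) (<⇒≤ b<a))
  ... | tri≈ _ b≡a _ = trans (back-diagonal (circulant D) a b (sym b≡a))
          (sym (trans (cong (λ z → inBack (toℕ a) z (D (offset a b))) e) (inBack-diagonal (toℕ a) (D (offset a b)))))
    where
    e : toℕ (offset a b) ≡ 0
    e = trans (toℕ-offset a b) (trans (cong (offsetℕ n (toℕ a)) b≡a) (offsetℕ-self n (toℕ a)))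
  ... | tri> _ _ a<b = trans (back-above (circulant D) a b a<b) (sym (inBack-right (toℕ a) (toℕ (offset a b)) _
          (≤-trans (+-monoˡ-≤ (toℕ a) (m<n⇒0<n∸m (toℕ<n b))) (≤-reflexive (sym e)))))
    where
    e : toℕ (offset a b) ≡ (n ∸ toℕ b) + toℕ a
    e = trans (toℕ-offset a b) (offsetℕ-> n (toℕ a) (toℕ b) a<b)

  size-back-circulant : ∀ (D : Fin n → Bool) → size (back (circulant D)) ≡ sizeRows (backRow D)
  size-back-circulant D = sizeRows-ext _ _ (λ a →
    trans (count-ext (back-circulant D a)) (count-involution (offset a) (offset-involutive a) (backRow D a)))

  -- Moving a 1 of D from offset p+1 down to offset p ≥ 1 enlarges the back
  -- set by exactly two: row p gains the cells at offsets p and p+1, while every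
  -- other row merely exchanges one cell for another.
  module MoveDown (D D′ : Fin n → Bool) (p p₁ : Fin n) (p₁≡1+p : toℕ p₁ ≡ suc (toℕ p)) (1≤p : 1 ≤ toℕ p)
    (D-p : D p ≡ false) (D-p₁ : D p₁ ≡ true) (D′-p : D′ p ≡ true) (D′-p₁ : D′ p₁ ≡ false)
    (same : ∀ x → x ≢ p → x ≢ p₁ → D′ x ≡ D x) where

    p≢p₁ : p ≢ p₁
    p≢p₁ e = <-irrefl (trans (cong toℕ e) p₁≡1+p) ≤-refl

    count-same : count D′ ≡ count D
    count-same = count-swap D D′ p₁ p D-p₁ D-p D′-p₁ D′-p (λ x x≢p₁ x≢p → same x x≢p x≢p₁)

    same-backRow : ∀ a x → x ≢ p → x ≢ p₁ → backRow D′ a x ≡ backRow D a x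
    same-backRow a x x≢p x≢p₁ = cong (inBack (toℕ a) (toℕ x)) (same x x≢p x≢p₁)

    1≤p₁ : 1 ≤ toℕ p₁
    1≤p₁ = ≤-trans (s≤s z≤n) (≤-reflexive (sym p₁≡1+p))

    row-p : count (backRow D′ p) ≡ 2 + count (backRow D p)
    row-p = count-raise₂ (backRow D p) (backRow D′ p) p p₁ p≢p₁
      (trans (cong (inBack (toℕ p) (toℕ p)) D-p) (inBack-left (toℕ p) (toℕ p) false 1≤p ≤-refl))
      (trans (cong (inBack (toℕ p) (toℕ p₁)) D-p₁) (inBack-right (toℕ p) (toℕ p₁) true (≤-reflexive (sym p₁≡1+p))))
      (trans (cong (inBack (toℕ p) (toℕ p)) D′-p) (inBack-left (toℕ p) (toℕ p) true 1≤p ≤-refl))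
      (trans (cong (inBack (toℕ p) (toℕ p₁)) D′-p₁) (inBack-right (toℕ p) (toℕ p₁) false (≤-reflexive (sym p₁≡1+p))))
      (same-backRow p)

    row-other : ∀ a → a ≢ p → count (backRow D′ a) ≡ count (backRow D a)
    row-other a a≢p with <-cmp (toℕ a) (toℕ p)
    ... | tri< a<p _ _ = count-swap (backRow D a) (backRow D′ a) p p₁
          (trans (cong (inBack (toℕ a) (toℕ p)) D-p) (inBack-right (toℕ a) (toℕ p) false a<p))
          (trans (cong (inBack (toℕ a) (toℕ p₁)) D-p₁) (inBack-right (toℕ a) (toℕ p₁) true a<p₁))
          (trans (cong (inBack (toℕ a) (toℕ p)) D′-p) (inBack-right (toℕ a) (toℕ p) true a<p))
          (trans (cong (inBack (toℕ a) (toℕ p₁)) D′-p₁) (inBack-right (toℕ a) (toℕ p₁) false a<p₁))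
          (same-backRow a)
      where
      a<p₁ : toℕ a < toℕ p₁
      a<p₁ = ≤-trans a<p (≤-trans (n≤1+n _) (≤-reflexive (sym p₁≡1+p)))
    ... | tri≈ _ a≡p _ = ⊥-elim (a≢p (toℕ-injective a≡p))
    ... | tri> _ _ p<a = count-swap (backRow D a) (backRow D′ a) p₁ p
          (trans (cong (inBack (toℕ a) (toℕ p₁)) D-p₁) (inBack-left (toℕ a) (toℕ p₁) true 1≤p₁ p₁≤a))
          (trans (cong (inBack (toℕ a) (toℕ p)) D-p) (inBack-left (toℕ a) (toℕ p) false 1≤p (<⇒≤ p<a)))
          (trans (cong (inBack (toℕ a) (toℕ p₁)) D′-p₁) (inBack-left (toℕ a) (toℕ p₁) false 1≤p₁ p₁≤a))
          (trans (cong (inBack (toℕ a) (toℕ p)) D′-p) (inBack-left (toℕ a) (toℕ p) true 1≤p (<⇒≤ p<a)))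
          (λ x x≢p₁ x≢p → same-backRow a x x≢p x≢p₁)
      where
      p₁≤a : toℕ p₁ ≤ toℕ a
      p₁≤a = ≤-trans (≤-reflexive p₁≡1+p) p<a

    size-grows : sizeRows (backRow D′) ≡ 2 + sizeRows (backRow D)
    size-grows = sizeRows-raise (backRow D) (backRow D′) p 2 row-other row-p

circulant-diagonal : ∀ {n} (D : Fin n → Bool) → (∀ d → toℕ d ≡ 0 → D d ≡ true) →
  ∀ t → circulant D t t ≡ true
circulant-diagonal {n} D D-0 t = D-0 (offset t t) (trans (toℕ-offset t t) (offsetℕ-self n (toℕ t)))

circulant-shaped : ∀ {n} (D : Fin n → Bool) → (∀ d → toℕ d ≡ 0 → D d ≡ true) →
  (∀ d → toℕ d ≡ 1 → D d ≡ false) → Shaped (circulant D)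
circulant-shaped {n} D D-0 D-1 = record
  { subdiagonal-zero = λ t s e → D-1 (offset t s) (offset-one t s e)
  ; diagonal-one     = λ t _ → circulant-diagonal D D-0 t
  ; last-diagonal    = λ j D-jj → clash (circulant-diagonal D D-0 j) D-jj
  }
  where
  offset-one : ∀ t s → toℕ t ≡ suc (toℕ s) → toℕ (offset t s) ≡ 1
  offset-one t s e = begin
    toℕ (offset t s)            ≡⟨ toℕ-offset t s ⟩
    offsetℕ n (toℕ t) (toℕ s)   ≡⟨ offsetℕ-≤ n (toℕ t) (toℕ s) (≤-trans (n≤1+n _) (≤-reflexive (sym e))) ⟩
    toℕ t ∸ toℕ s               ≡⟨ cong (_∸ toℕ s) e ⟩
    suc (toℕ s) ∸ toℕ s         ≡⟨ m+n∸n≡m 1 (toℕ s) ⟩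
    1                           ∎
    where open ≡-Reasoning

-- Counting over natural-number indices

countℕ : ℕ → (ℕ → Bool) → ℕ
countℕ zero    g = 0
countℕ (suc k) g = b2n (g 0) + countℕ k (λ d → g (suc d))

count-as-countℕ : ∀ {n} (g : ℕ → Bool) → count {n} (λ d → g (toℕ d)) ≡ countℕ n g
count-as-countℕ {zero}  g = refl
count-as-countℕ {suc n} g = cong (b2n (g 0) +_) (count-as-countℕ {n} (λ d → g (suc d)))

countℕ-none : ∀ k (g : ℕ → Bool) → (∀ d → d < k → g d ≡ false) → countℕ k g ≡ 0
countℕ-none zero    g none = refl
countℕ-none (suc k) g none rewrite none 0 (s≤s z≤n) =
  countℕ-none k (λ d → g (suc d)) (λ d d<k → none (suc d) (s≤s d<k))

countℕ-interval : ∀ k lo hi (g : ℕ → Bool) → hi ≤ k →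
  (∀ d → d < k → lo ≤ d → d < hi → g d ≡ true) →
  (∀ d → d < k → (d < lo ⊎ hi ≤ d) → g d ≡ false) → countℕ k g ≡ hi ∸ lo
countℕ-interval k lo zero g hi≤k inside outside =
  trans (countℕ-none k g (λ d d<k → outside d d<k (inj₂ z≤n))) (sym (0∸n≡0 lo))
countℕ-interval zero lo (suc hi) g () inside outside
countℕ-interval (suc k) zero (suc hi) g (s≤s hi≤k) inside outside rewrite inside 0 (s≤s z≤n) z≤n (s≤s z≤n) =
  cong suc (countℕ-interval k zero hi (λ d → g (suc d)) hi≤k
    (λ d d<k _ d<hi → inside (suc d) (s≤s d<k) z≤n (s≤s d<hi))
    (λ d d<k out → outside (suc d) (s≤s d<k) (shift out)))
  where
  shift : ∀ {d} → (d < 0 ⊎ hi ≤ d) → (suc d < 0 ⊎ suc hi ≤ suc d)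
  shift (inj₂ hi≤d) = inj₂ (s≤s hi≤d)
countℕ-interval (suc k) (suc lo) (suc hi) g (s≤s hi≤k) inside outside rewrite outside 0 (s≤s z≤n) (inj₁ (s≤s z≤n)) =
  countℕ-interval k lo hi (λ d → g (suc d)) hi≤k
    (λ d d<k lo≤d d<hi → inside (suc d) (s≤s d<k) (s≤s lo≤d) (s≤s d<hi))
    (λ d d<k out → outside (suc d) (s≤s d<k) (shift out))
  where
  shift : ∀ {d} → (d < lo ⊎ hi ≤ d) → (suc d < suc lo ⊎ suc hi ≤ suc d)
  shift (inj₁ d<lo) = inj₁ (s≤s d<lo)
  shift (inj₂ hi≤d) = inj₂ (s≤s hi≤d)

sumℕ : ℕ → (ℕ → ℕ) → ℕ
sumℕ zero    h = 0
sumℕ (suc k) h = h 0 + sumℕ k (λ t → h (suc t))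

sizeRows-as-sumℕ : ∀ {r c} (S : Fin r → Fin c → Bool) (h : ℕ → ℕ) →
  (∀ a → count (S a) ≡ h (toℕ a)) → sizeRows S ≡ sumℕ r h
sizeRows-as-sumℕ {zero}  S h e = refl
sizeRows-as-sumℕ {suc r} S h e =
  cong₂ _+_ (e zero) (sizeRows-as-sumℕ (λ i → S (suc i)) (λ t → h (suc t)) (λ a → e (suc a)))

sumℕ-ext : ∀ k (h h′ : ℕ → ℕ) → (∀ d → d < k → h d ≡ h′ d) → sumℕ k h ≡ sumℕ k h′
sumℕ-ext zero    h h′ e = refl
sumℕ-ext (suc k) h h′ e = cong₂ _+_ (e 0 (s≤s z≤n)) (sumℕ-ext k _ _ (λ d d<k → e (suc d) (s≤s d<k)))

sumℕ-split : ∀ x y (h : ℕ → ℕ) → sumℕ (x + y) h ≡ sumℕ x h + sumℕ y (λ t → h (x + t))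
sumℕ-split zero    y h = refl
sumℕ-split (suc x) y h = trans (cong (h 0 +_) (sumℕ-split x y (λ t → h (suc t)))) (sym (+-assoc (h 0) _ _))

sumℕ-suc : ∀ k (f : ℕ → ℕ) → sumℕ k (λ t → suc (f t)) ≡ k + sumℕ k f
sumℕ-suc zero    f = refl
sumℕ-suc (suc k) f = cong suc (begin
  f 0 + sumℕ k (λ t → suc (f (suc t)))  ≡⟨ cong (f 0 +_) (sumℕ-suc k (λ t → f (suc t))) ⟩
  f 0 + (k + R)                         ≡⟨ sym (+-assoc (f 0) k R) ⟩
  f 0 + k + R                           ≡⟨ cong (_+ R) (+-comm (f 0) k) ⟩
  k + f 0 + R                           ≡⟨ +-assoc k (f 0) R ⟩
  k + (f 0 + R)                         ∎)
  where
  open ≡-Reasoning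
  R : ℕ
  R = sumℕ k (λ t → f (suc t))

sum-two-triangles : ∀ m → sumℕ m (λ a → m ∸ a) + sumℕ m (λ t → t) ≡ m * m
sum-two-triangles zero    = refl
sum-two-triangles (suc m) =
  trans (cong (λ z → (suc m + sumℕ m (λ a → m ∸ a)) + z) (sumℕ-suc m (λ t → t)))
        (step m (sumℕ m (λ a → m ∸ a)) (sumℕ m (λ t → t)) (sum-two-triangles m))
  where
  step : ∀ m X Y → X + Y ≡ m * m → (suc m + X) + (m + Y) ≡ suc m * suc m
  step m X Y e = trans (regroup m X Y) (trans (cong ((suc m + m) +_) e) (square m))
    where
    regroup : ∀ m X Y → (suc m + X) + (m + Y) ≡ (suc m + m) + (X + Y)
    regroup = solve-∀
    square : ∀ m → (suc m + m) + m * m ≡ suc m * suc m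
    square = solve-∀

sum-distance-to-middle : ∀ m → sumℕ (2 * m) (λ a → (a ∸ m) + (m ∸ a)) ≡ m * m
sum-distance-to-middle m = begin
  sumℕ (2 * m) h                             ≡⟨ cong (λ z → sumℕ z h) (cong (m +_) (+-identityʳ m)) ⟩
  sumℕ (m + m) h                             ≡⟨ sumℕ-split m m h ⟩
  sumℕ m h + sumℕ m (λ t → h (m + t))        ≡⟨ cong₂ _+_ (sumℕ-ext m h (λ a → m ∸ a) left)
                                                          (sumℕ-ext m _ (λ t → t) right) ⟩
  sumℕ m (λ a → m ∸ a) + sumℕ m (λ t → t)    ≡⟨ sum-two-triangles m ⟩
  m * m                                      ∎
  where
  open ≡-Reasoning
  h = λ a → (a ∸ m) + (m ∸ a)
  left : ∀ a → a < m → h a ≡ m ∸ a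
  left a a<m = cong (_+ (m ∸ a)) (m≤n⇒m∸n≡0 (<⇒≤ a<m))
  right : ∀ t → t < m → h (m + t) ≡ t
  right t _ = trans (cong₂ _+_ (m+n∸m≡n m t) (m≤n⇒m∸n≡0 (m≤m+n m t))) (+-identityʳ t)

-- The circulant family.  For q < m and r < m put L = m − q; the vector
-- D m q r has its 1s at offset 0 and at the offsets L ≤ d < L + m other than
-- L + r (the "hole").
InFamily : ℕ → ℕ → ℕ → ℕ → Set
InFamily m q r d = d ≡ 0 ⊎ ((m ∸ q) ≤ d × d < (m ∸ q) + m × d ≢ (m ∸ q) + r)

InFamily? : ∀ m q r d → Dec (InFamily m q r d)
InFamily? m q r d = (d ≟ 0) ⊎-dec (((m ∸ q) ≤? d) ×-dec ((d <? (m ∸ q) + m) ×-dec ¬? (d ≟ (m ∸ q) + r)))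

familyℕ : ℕ → ℕ → ℕ → ℕ → Bool
familyℕ m q r d = does (InFamily? m q r d)

family : ∀ m q r → Fin (2 * m) → Bool
family m q r d = familyℕ m q r (toℕ d)

∸-suc : ∀ m q → q < m → m ∸ q ≡ suc (m ∸ suc q)
∸-suc m q q<m = +-∸-assoc 1 q<m

family-0 : ∀ m q r (d : Fin (2 * m)) → toℕ d ≡ 0 → family m q r d ≡ true
family-0 m q r d e = dec-true (InFamily? m q r (toℕ d)) (inj₁ e)

-- Offset 1 is empty as long as the block [L, L + m) starts at L ≥ 2, or at
-- L = 1 with the hole at offset 1.
family-1 : ∀ m q r → q < m → (suc q < m ⊎ r ≡ 0) → ∀ (d : Fin (2 * m)) → toℕ d ≡ 1 →
  family m q r d ≡ false
family-1 m q r q<m small d d≡1 = dec-false (InFamily? m q r (toℕ d)) not-in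
  where
  not-in : ¬ InFamily m q r (toℕ d)
  not-in (inj₁ d≡0) = 1+n≢0 (trans (sym d≡1) d≡0)
  not-in (inj₂ (L≤d , _ , not-hole)) = excluded small
    where
    L≤1 : m ∸ q ≤ 1
    L≤1 = ≤-trans L≤d (≤-reflexive d≡1)
    excluded : suc q < m ⊎ r ≡ 0 → ⊥
    excluded (inj₁ q+1<m) = <⇒≱ (s≤s (m<n⇒0<n∸m q+1<m)) (≤-trans (≤-reflexive (sym (∸-suc m q q<m))) L≤1)
    excluded (inj₂ r≡0) = not-hole (trans d≡1 (sym (cong₂ _+_ (≤-antisym L≤1 (m<n⇒0<n∸m q<m)) r≡0)))

block<2m : ∀ m q x → x < (m ∸ q) + m → x < 2 * m
block<2m m q x x<L+m = ≤-trans x<L+m (≤-trans (+-monoˡ-≤ m (m∸n≤m m q)) (≤-reflexive (cong (m +_) (sym (+-identityʳ m)))))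

module Family (k : ℕ) where
  m n : ℕ
  m = suc k
  n = 2 * m

  Invariant : ℕ → ℕ → Set
  Invariant q r = count (family m q r) ≡ m × sizeRows (backRow (family m q r)) ≡ m * m + 2 * (q * k + r)

  -- Moving the hole from L + r to L + r + 1 moves the 1 at L + r + 1 down by one.
  shift-hole : ∀ q r → q < m → suc r < m → Invariant q r → Invariant q (suc r)
  shift-hole q r q<m r+1<m (count-D , size-D) =
    trans Move.count-same count-D ,
    trans Move.size-grows (trans (cong (2 +_) size-D) (two-more (m * m) (q * k) r))
    where
    L : ℕ
    L = m ∸ q
    1≤L : 1 ≤ L
    1≤L = ≤-trans (s≤s z≤n) (≤-reflexive (sym (∸-suc m q q<m)))
    r<m : r < m
    r<m = <-trans (n<1+n r) r+1<m
    p p₁ : Fin n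
    p = fromℕ< (block<2m m q (L + r) (+-monoʳ-< L r<m))
    p₁ = fromℕ< (block<2m m q (L + suc r) (+-monoʳ-< L r+1<m))
    p≡ : toℕ p ≡ L + r
    p≡ = toℕ-fromℕ< _
    p₁≡ : toℕ p₁ ≡ L + suc r
    p₁≡ = toℕ-fromℕ< _
    p₁≡1+p : toℕ p₁ ≡ suc (toℕ p)
    p₁≡1+p = trans p₁≡ (trans (+-suc L r) (cong suc (sym p≡)))
    positive : ∀ x → x ≡ L + r ⊎ x ≡ L + suc r → x ≢ 0
    positive x (inj₁ e) e₀ = <⇒≱ (≤-trans 1≤L (m≤m+n L r)) (≤-reflexive (trans (sym e) e₀))
    positive x (inj₂ e) e₀ = <⇒≱ (≤-trans 1≤L (m≤m+n L (suc r))) (≤-reflexive (trans (sym e) e₀))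
    holes-differ : L + suc r ≢ L + r
    holes-differ e = <-irrefl (sym (+-cancelˡ-≡ L _ _ e)) (n<1+n r)
    D-p : family m q r p ≡ false
    D-p = dec-false (InFamily? m q r (toℕ p)) λ
      { (inj₁ e) → positive _ (inj₁ p≡) e ; (inj₂ (_ , _ , not-hole)) → not-hole p≡ }
    D-p₁ : family m q r p₁ ≡ true
    D-p₁ = dec-true (InFamily? m q r (toℕ p₁)) (inj₂ (≤-trans (m≤m+n L (suc r)) (≤-reflexive (sym p₁≡)) ,
      ≤-trans (s≤s (≤-reflexive p₁≡)) (+-monoʳ-< L r+1<m) , λ e → holes-differ (trans (sym p₁≡) e)))
    D′-p : family m q (suc r) p ≡ true
    D′-p = dec-true (InFamily? m q (suc r) (toℕ p)) (inj₂ (≤-trans (m≤m+n L r) (≤-reflexive (sym p≡)) ,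
      ≤-trans (s≤s (≤-reflexive p≡)) (+-monoʳ-< L r<m) , λ e → holes-differ (sym (trans (sym p≡) e))))
    D′-p₁ : family m q (suc r) p₁ ≡ false
    D′-p₁ = dec-false (InFamily? m q (suc r) (toℕ p₁)) λ
      { (inj₁ e) → positive _ (inj₂ p₁≡) e ; (inj₂ (_ , _ , not-hole)) → not-hole p₁≡ }
    same : ∀ x → x ≢ p → x ≢ p₁ → family m q (suc r) x ≡ family m q r x
    same x x≢p x≢p₁ = does-⇔ (mk⇔ to from) (InFamily? m q (suc r) (toℕ x)) (InFamily? m q r (toℕ x))
      where
      to : InFamily m q (suc r) (toℕ x) → InFamily m q r (toℕ x)
      to (inj₁ e) = inj₁ e
      to (inj₂ (u , v , _)) = inj₂ (u , v , λ e → x≢p (toℕ-injective (trans e (sym p≡))))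
      from : InFamily m q r (toℕ x) → InFamily m q (suc r) (toℕ x)
      from (inj₁ e) = inj₁ e
      from (inj₂ (u , v , _)) = inj₂ (u , v , λ e → x≢p₁ (toℕ-injective (trans e (sym p₁≡))))
    1≤p : 1 ≤ toℕ p
    1≤p = ≤-trans (≤-trans 1≤L (m≤m+n L r)) (≤-reflexive (sym p≡))
    module Move = MoveDown (family m q r) (family m q (suc r)) p p₁ p₁≡1+p 1≤p D-p D-p₁ D′-p D′-p₁ same
    two-more : ∀ A B r → 2 + (A + 2 * (B + r)) ≡ A + 2 * (B + suc r)
    two-more = solve-∀

  -- With the hole at the end of the block, D m q k = D m (q+1) 0.
  next-block : ∀ q → suc q < m → Invariant q k → Invariant (suc q) 0
  next-block q q+1<m (count-D , size-D) =
    trans (sym (count-ext same)) count-D ,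
    trans (sym (sizeRows-ext (backRow (family m q k)) (backRow (family m (suc q) 0))
                  (λ a → count-ext (λ d → cong (inBack (toℕ a) (toℕ d)) (same d)))))
          (trans size-D (regroup (m * m) q k))
    where
    L′ : ℕ
    L′ = m ∸ suc q
    L≡ : m ∸ q ≡ suc L′
    L≡ = ∸-suc m q (<-trans (n<1+n q) q+1<m)
    same : ∀ d → family m q k d ≡ family m (suc q) 0 d
    same d = does-⇔ (mk⇔ to from) (InFamily? m q k x) (InFamily? m (suc q) 0 x)
      where
      x : ℕ
      x = toℕ d
      to : InFamily m q k x → InFamily m (suc q) 0 x
      to (inj₁ e) = inj₁ e
      to (inj₂ (L≤x , x<L+m , not-hole)) = inj₂ (≤-trans (n≤1+n L′) L′<x , x<L′+m , λ e → <-irrefl (sym (trans e (+-identityʳ L′))) L′<x)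
        where
        L′<x : suc L′ ≤ x
        L′<x = ≤-trans (≤-reflexive (sym L≡)) L≤x
        x<L′+m : x < L′ + m
        x<L′+m with m≤n⇒m<n∨m≡n (≤-pred (≤-trans x<L+m (≤-reflexive (trans (cong (_+ m) L≡) (+-suc (suc L′) k)))))
        ... | inj₁ x<L′+m = ≤-trans x<L′+m (≤-reflexive (sym (+-suc L′ k)))
        ... | inj₂ x≡ = ⊥-elim (not-hole (trans x≡ (cong (_+ k) (sym L≡))))
      from : InFamily m (suc q) 0 x → InFamily m q k x
      from (inj₁ e) = inj₁ e
      from (inj₂ (L′≤x , x<L′+m , not-hole)) =
        inj₂ (≤-trans (≤-reflexive L≡) L′<x ,
              ≤-trans x<L′+m (≤-trans (+-monoˡ-≤ m (n≤1+n L′)) (≤-reflexive (cong (_+ m) (sym L≡)))) ,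
              λ e → <-irrefl (trans e (trans (cong (_+ k) L≡) (sym (+-suc L′ k)))) x<L′+m)
        where
        L′<x : suc L′ ≤ x
        L′<x with m≤n⇒m<n∨m≡n L′≤x
        ... | inj₁ L′<x = L′<x
        ... | inj₂ e = ⊥-elim (not-hole (trans (sym e) (sym (+-identityʳ L′))))
    regroup : ∀ A q k → A + 2 * (q * k + k) ≡ A + 2 * (suc q * k + 0)
    regroup = solve-∀

  base : ℕ → Bool
  base = familyℕ m 0 0

  base-0 : base 0 ≡ true
  base-0 = dec-true (InFamily? m 0 0 0) (inj₁ refl)

  base-low : ∀ x → 1 ≤ x → x ≤ m → base x ≡ false
  base-low x 1≤x x≤m = dec-false (InFamily? m 0 0 x) λ
    { (inj₁ e) → <⇒≱ 1≤x (≤-reflexive e)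
    ; (inj₂ (m≤x , _ , not-hole)) → not-hole (trans (≤-antisym x≤m m≤x) (sym (+-identityʳ m))) }

  base-high : ∀ x → m < x → x < 2 * m → base x ≡ true
  base-high x m<x x<2m = dec-true (InFamily? m 0 0 x) (inj₂ (<⇒≤ m<x ,
    ≤-trans x<2m (≤-reflexive (cong (m +_) (+-identityʳ m))) , λ e → <-irrefl (sym (trans e (+-identityʳ m))) m<x))

  base-count : count (family m 0 0) ≡ m
  base-count = trans (count-as-countℕ {n} base) (trans (cong (b2n (base 0) +_) tail-count) (cong (_+ k) (cong b2n base-0)))
    where
    N : ℕ
    N = k + suc (k + 0)
    outside : ∀ d → d < N → (d < m ⊎ N ≤ d) → base (suc d) ≡ false
    outside d d<N (inj₁ d<m) = base-low (suc d) (s≤s z≤n) d<m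
    outside d d<N (inj₂ N≤d) = ⊥-elim (<⇒≱ d<N N≤d)
    tail-count : countℕ N (λ d → base (suc d)) ≡ k
    tail-count = trans (countℕ-interval N m N (λ d → base (suc d)) ≤-refl
       (λ d d<N m≤d _ → base-high (suc d) (s≤s m≤d) (s≤s d<N)) outside)
       (trans (cong (_∸ m) (+-suc k (k + 0))) (trans (m+n∸m≡n k (k + 0)) (+-identityʳ k)))

  -- Row a of the base back set has |a − m| cells: the offsets between a and m.
  base-row : ∀ (a : Fin n) → count (backRow (family m 0 0) a) ≡ (toℕ a ∸ m) + (m ∸ toℕ a)
  base-row a = trans (count-as-countℕ {n} G) (by-position (<-cmp A m))
    where
    A : ℕ
    A = toℕ a
    G : ℕ → Bool
    G x = inBack A x (base x)
    from-middle : m ≤ A → countℕ n G ≡ (A ∸ m) + (m ∸ A)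
    from-middle m≤A = trans (countℕ-interval n (suc m) (suc A) G (toℕ<n a) inside outside)
      (sym (trans (cong ((A ∸ m) +_) (m≤n⇒m∸n≡0 m≤A)) (+-identityʳ _)))
      where
      inside : ∀ x → x < n → suc m ≤ x → x < suc A → G x ≡ true
      inside x x<n m<x x≤A = trans (inBack-left A x (base x) (≤-trans (s≤s z≤n) m<x) (≤-pred x≤A)) (base-high x m<x x<n)
      outside : ∀ x → x < n → (x < suc m ⊎ suc A ≤ x) → G x ≡ false
      outside zero _ _ = inBack-diagonal A (base 0)
      outside (suc x) _ (inj₁ x<m) =
        trans (inBack-left A (suc x) (base (suc x)) (s≤s z≤n) (≤-trans (≤-pred x<m) m≤A)) (base-low (suc x) (s≤s z≤n) (≤-pred x<m))
      outside (suc x) x<n (inj₂ A<x) =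
        trans (inBack-right A (suc x) (base (suc x)) A<x) (cong not (base-high (suc x) (≤-trans (s≤s m≤A) A<x) x<n))
    by-position : Tri (A < m) (A ≡ m) (m < A) → countℕ n G ≡ (A ∸ m) + (m ∸ A)
    by-position (tri< A<m _ _) = trans (countℕ-interval n (suc A) (suc m) G m<n inside outside)
      (sym (cong (_+ (m ∸ A)) (m≤n⇒m∸n≡0 (<⇒≤ A<m))))
      where
      m<n : suc m ≤ n
      m<n = s≤s (≤-trans (≤-reflexive (cong suc (sym (+-identityʳ k)))) (m≤n+m (suc (k + 0)) k))
      inside : ∀ x → x < n → suc A ≤ x → x < suc m → G x ≡ true
      inside x _ A<x x≤m = trans (inBack-right A x (base x) A<x) (cong not (base-low x (≤-trans (s≤s z≤n) A<x) (≤-pred x≤m)))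
      outside : ∀ x → x < n → (x < suc A ⊎ suc m ≤ x) → G x ≡ false
      outside zero _ _ = inBack-diagonal A (base 0)
      outside (suc x) _ (inj₁ x<A) =
        trans (inBack-left A (suc x) (base (suc x)) (s≤s z≤n) (≤-pred x<A)) (base-low (suc x) (s≤s z≤n) (≤-trans (≤-pred x<A) (<⇒≤ A<m)))
      outside (suc x) x<n (inj₂ m<x) =
        trans (inBack-right A (suc x) (base (suc x)) (≤-trans (s≤s (<⇒≤ A<m)) m<x)) (cong not (base-high (suc x) m<x x<n))
    by-position (tri≈ _ A≡m _) = from-middle (≤-reflexive (sym A≡m))
    by-position (tri> _ _ m<A) = from-middle (<⇒≤ m<A)

  base-size : sizeRows (backRow (family m 0 0)) ≡ m * m + 2 * (0 * k + 0)
  base-size = trans (sizeRows-as-sumℕ (backRow (family m 0 0)) (λ a → (a ∸ m) + (m ∸ a)) base-row)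
                    (trans (sum-distance-to-middle m) (sym (+-identityʳ (m * m))))

  invariant : ∀ q r → q < m → r < m → Invariant q r
  invariant q r q<m r<m = along-block q q<m (start q q<m) r r<m
    where
    along-block : ∀ q → q < m → Invariant q 0 → ∀ r → r < m → Invariant q r
    along-block q q<m inv₀ zero    _     = inv₀
    along-block q q<m inv₀ (suc r) r+1<m =
      shift-hole q r q<m r+1<m (along-block q q<m inv₀ r (<-trans (n<1+n r) r+1<m))
    start : ∀ q → q < m → Invariant q 0
    start zero    _     = base-count , base-size
    start (suc q) q+1<m = next-block q q+1<m
      (along-block q q<m′ (start q q<m′) k ≤-refl)
      where
      q<m′ : q < m
      q<m′ = <-trans (n<1+n q) q+1<m

-- The family of circulants realises every size m² + 2s with s ≤ (m−1)²,
-- writing s = qk + r with k = m − 1 and r < m (and r = 0 when q = k, so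
-- that offset 1 stays empty).
module CirculantMember (k q r : ℕ) (q<m : q < suc k) (r<m : r < suc k) (small : suc q < suc k ⊎ r ≡ 0) where
  m : ℕ
  m = suc k
  M : Matrix (2 * m)
  M = circulant (family m q r)

  invariant-qr : Family.Invariant k q r
  invariant-qr = Family.invariant k q r q<m r<m

  Λ : InΛ (2 * m) m M
  Λ = circulant-Λ (family m q r) (proj₁ invariant-qr)

  shaped : Shaped M
  shaped = circulant-shaped (family m q r) (family-0 m q r) (family-1 m q r q<m small)

  diagonal : ∀ t → M t t ≡ true
  diagonal = circulant-diagonal (family m q r) (family-0 m q r)

  size-back : size (back M) ≡ m * m + 2 * (q * k + r)
  size-back = trans (size-back-circulant (family m q r)) (proj₂ invariant-qr)

-- Interchanges.  Replacing a 2×2 submatrix [1 0; 0 1] on rows r₁, r₂ and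
-- columns c₁, c₂ by [0 1; 1 0] is a switch, so it preserves all line sums.
module Interchange {n} (M : Matrix n) (r₁ r₂ c₁ c₂ : Fin n)
  (M₁₁ : M r₁ c₁ ≡ true) (M₁₂ : M r₁ c₂ ≡ false) (M₂₁ : M r₂ c₁ ≡ false) (M₂₂ : M r₂ c₂ ≡ true) where

  Corners : Fin n → Fin n → Set
  Corners a b = (a ≡ r₁ ⊎ a ≡ r₂) × (b ≡ c₁ ⊎ b ≡ c₂)

  Corners? : ∀ a b → Dec (Corners a b)
  Corners? a b = ((a ≟ᶠ r₁) ⊎-dec (a ≟ᶠ r₂)) ×-dec ((b ≟ᶠ c₁) ⊎-dec (b ≟ᶠ c₂))

  M′ : Matrix n
  M′ = switch Corners Corners? M

  swap : ∀ {A : Set} {x y z : A} → x ≡ y ⊎ x ≡ z → x ≡ z ⊎ x ≡ y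
  swap (inj₁ e) = inj₂ e
  swap (inj₂ e) = inj₁ e

  rows : ∀ a → Switchable (M a) (Corners a)
  rows a with a ≟ᶠ r₁ | a ≟ᶠ r₂
  ... | yes refl | _ = inj₂ (c₁ , c₂ , M₁₁ , M₁₂ , (inj₁ refl , inj₁ refl) , (inj₁ refl , inj₂ refl) , λ _ → proj₂)
  ... | no _ | yes refl = inj₂ (c₂ , c₁ , M₂₂ , M₂₁ , (inj₂ refl , inj₂ refl) , (inj₂ refl , inj₁ refl) , λ _ → swap ∘ proj₂)
  ... | no a≢r₁ | no a≢r₂ = inj₁ λ { x (inj₁ e , _) → a≢r₁ e ; x (inj₂ e , _) → a≢r₂ e }

  cols : ∀ b → Switchable (λ a → M a b) (λ a → Corners a b)
  cols b with b ≟ᶠ c₁ | b ≟ᶠ c₂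
  ... | yes refl | _ = inj₂ (r₁ , r₂ , M₁₁ , M₂₁ , (inj₁ refl , inj₁ refl) , (inj₂ refl , inj₁ refl) , λ _ → proj₁)
  ... | no _ | yes refl = inj₂ (r₂ , r₁ , M₂₂ , M₁₂ , (inj₂ refl , inj₂ refl) , (inj₁ refl , inj₂ refl) , λ _ → swap ∘ proj₁)
  ... | no b≢c₁ | no b≢c₂ = inj₁ λ { x (_ , inj₁ e) → b≢c₁ e ; x (_ , inj₂ e) → b≢c₂ e }

  Λ′ : ∀ {x} → InΛ n x M → InΛ n x M′
  Λ′ Λ = switch-Λ Corners Corners? M Λ rows cols

  M′₁₂ : M′ r₁ c₂ ≡ true
  M′₁₂ = trans (switch-inside Corners Corners? M r₁ c₂ (inj₁ refl , inj₂ refl)) (cong not M₁₂)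
  M′₂₁ : M′ r₂ c₁ ≡ true
  M′₂₁ = trans (switch-inside Corners Corners? M r₂ c₁ (inj₂ refl , inj₁ refl)) (cong not M₂₁)
  M′₂₂ : M′ r₂ c₂ ≡ false
  M′₂₂ = trans (switch-inside Corners Corners? M r₂ c₂ (inj₂ refl , inj₂ refl)) (cong not M₂₂)

  outside : ∀ a b → ¬ Corners a b → M′ a b ≡ M a b
  outside = switch-outside Corners Corners? M

  outside-rows : ∀ a b → a ≢ r₁ → a ≢ r₂ → M′ a b ≡ M a b
  outside-rows a b a≢r₁ a≢r₂ = outside a b λ { (inj₁ e , _) → a≢r₁ e ; (inj₂ e , _) → a≢r₂ e }

  outside-cols : ∀ a b → b ≢ c₁ → b ≢ c₂ → M′ a b ≡ M a b
  outside-cols a b b≢c₁ b≢c₂ = outside a b λ { (_ , inj₁ e) → b≢c₁ e ; (_ , inj₂ e) → b≢c₂ e }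

corner-interchange-shaped : ∀ {n} (M : Matrix n) (l x y : Fin n)
  (M-ll : M l l ≡ true) (M-ly : M l y ≡ false) (M-xl : M x l ≡ false) (M-xy : M x y ≡ true) →
  let open Interchange M l x l y M-ll M-ly M-xl M-xy in
  (∀ t → M t t ≡ true) → (∀ t s → toℕ t ≡ suc (toℕ s) → M t s ≡ false) →
  suc (toℕ l) ≡ n → x ≢ y → suc (toℕ y) ≢ toℕ l → toℕ x ≢ suc (toℕ y) →
  (p : Fin n) → suc (toℕ p) ≡ toℕ l → M′ p l ≡ true → Shaped M′
corner-interchange-shaped {n} M l x y M-ll M-ly M-xl M-xy diagonal subdiagonal l-last x≢y y+1≢l x≢y+1 p p+1≡l M′-pl =
  record
  { subdiagonal-zero = λ t s e → trans (outside t s (not-subdiagonal t s e)) (subdiagonal t s e)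
  ; diagonal-one     = λ t t+1<n → diagonal-M′ t (not-last t t+1<n)
  ; last-diagonal    = last-diagonal
  }
  where
  open Interchange M l x l y M-ll M-ly M-xl M-xy
  not-last : ∀ t → suc (toℕ t) < n → t ≢ l
  not-last t t+1<n refl = <-irrefl l-last t+1<n
  diagonal-M′ : ∀ t → t ≢ l → M′ t t ≡ true
  diagonal-M′ t t≢l = trans (outside t t not-corner) (diagonal t)
    where
    not-corner : ¬ Corners t t
    not-corner (inj₁ t≡l , _)      = t≢l t≡l
    not-corner (inj₂ _ , inj₁ t≡l) = t≢l t≡l
    not-corner (inj₂ refl , inj₂ t≡y) = x≢y t≡y
  not-subdiagonal : ∀ t s → toℕ t ≡ suc (toℕ s) → ¬ Corners t s
  not-subdiagonal t s e (inj₁ refl , inj₁ refl) = <-irrefl e (n<1+n _)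
  not-subdiagonal t s e (inj₁ refl , inj₂ refl) = y+1≢l (sym e)
  not-subdiagonal t s e (inj₂ refl , inj₁ refl) = <-irrefl (trans e l-last) (toℕ<n x)
  not-subdiagonal t s e (inj₂ refl , inj₂ refl) = x≢y+1 e
  last-diagonal : ∀ j → M′ j j ≡ false → Σ (Fin n) λ p → suc (toℕ p) ≡ toℕ j × M′ p j ≡ true
  last-diagonal j M′-jj = by-cases (j ≟ᶠ l)
    where
    by-cases : Dec (j ≡ l) → Σ (Fin n) λ p → suc (toℕ p) ≡ toℕ j × M′ p j ≡ true
    by-cases (yes refl) = p , p+1≡l , M′-pl
    by-cases (no j≢l)   = clash (diagonal-M′ j j≢l) M′-jj

HasCriticalOfSize : ℕ → ℕ → Set
HasCriticalOfSize m s = ∃[ M ] (InΛ (2 * m) m M × ∃[ S ] (IsCritical m M S × size S ≡ s))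

offset-≤ : ∀ {n} (a b : Fin n) {A B} → toℕ a ≡ A → toℕ b ≡ B → B ≤ A → toℕ (offset a b) ≡ A ∸ B
offset-≤ {n} a b refl refl B≤A = trans (toℕ-offset a b) (offsetℕ-≤ n _ _ B≤A)

offset-> : ∀ {n} (a b : Fin n) {A B} → toℕ a ≡ A → toℕ b ≡ B → A < B → toℕ (offset a b) ≡ (n ∸ B) + A
offset-> {n} a b refl refl A<B = trans (toℕ-offset a b) (offsetℕ-> n _ _ A<B)

2*suc : ∀ k → 2 * suc k ≡ suc (suc (2 * k))
2*suc = solve-∀

module Corner (k : ℕ) where
  m n : ℕ
  m = suc k
  n = 2 * m

  position : ∀ x → x < suc (suc (2 * k)) → Fin n
  position x x<n = fromℕ< (≤-trans x<n (≤-reflexive (sym (2*suc k))))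

  toℕ-position : ∀ x x<n → toℕ (position x x<n) ≡ x
  toℕ-position x x<n = toℕ-fromℕ< _

  l pl : Fin n
  l = position (suc (2 * k)) ≤-refl
  pl = position (2 * k) (n≤1+n _)

  l≡ : toℕ l ≡ suc (2 * k)
  l≡ = toℕ-position (suc (2 * k)) ≤-refl
  pl≡ : toℕ pl ≡ 2 * k
  pl≡ = toℕ-position (2 * k) (n≤1+n _)

  l-last : suc (toℕ l) ≡ n
  l-last = trans (cong suc l≡) (sym (2*suc k))

  pl+1≡l : suc (toℕ pl) ≡ toℕ l
  pl+1≡l = trans (cong suc pl≡) (sym l≡)

  pl<l : toℕ pl < toℕ l
  pl<l = ≤-reflexive pl+1≡l

  distinct : ∀ {a b : Fin n} → toℕ a ≢ toℕ b → a ≢ b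
  distinct ne refl = ne refl

  -- offset 1 from the left: (n − (2k+1)) + a = a + 1
  offset-to-l : ∀ a A → toℕ a ≡ A → A < suc (2 * k) → toℕ (offset a l) ≡ suc A
  offset-to-l a A a≡ A<l = trans (offset-> a l a≡ l≡ A<l)
    (cong (_+ A) (trans (cong (_∸ suc (2 * k)) (2*suc k)) (m+n∸n≡m 1 (suc (2 * k)))))

-- Odd sizes m² + 2r + 1 (r < k).  Starting from the circulant D m 0 r, apply
-- the interchange on rows l, 0 and columns l, j + 1 (where k = r + j + 1).
-- The back set gains the cell (l, j+1), while row 0 only exchanges (0,l) for
-- (0, j+1); the last diagonal entry becomes 0, rescued by (l−1, l).
module OddAbove (r j : ℕ) where
  k : ℕ
  k = suc (r + j)
  open Corner k
  open CirculantMember k 0 r (s≤s z≤n) (s≤s (≤-trans (m≤m+n r j) (n≤1+n _))) (inj₁ (s≤s (s≤s z≤n)))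
    hiding (m)

  j+1<n : suc j < suc (suc (2 * k))
  j+1<n = s≤s (s≤s (≤-trans (≤-trans (m≤n+m j r) (n≤1+n _)) (m≤m+n k (k + 0))))

  z y : Fin n
  z = position 0 (s≤s z≤n)
  y = position (suc j) j+1<n

  z≡ : toℕ z ≡ 0
  z≡ = toℕ-position 0 (s≤s z≤n)
  y≡ : toℕ y ≡ suc j
  y≡ = toℕ-position (suc j) j+1<n

  r<k : r < k
  r<k = s≤s (m≤m+n r j)

  in-block : ∀ (d : Fin n) → m ≤ toℕ d → toℕ d < m + m → toℕ d ≢ m + r → family m 0 r d ≡ true
  in-block d m≤d d<2m not-hole = dec-true (InFamily? m 0 r (toℕ d)) (inj₂ (m≤d , d<2m , not-hole))

  offset-ly : toℕ (offset l y) ≡ m + r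
  offset-ly = trans (offset-≤ l y l≡ y≡ (s≤s (≤-trans (≤-trans (m≤n+m j r) (n≤1+n _)) (m≤m+n k (k + 0)))))
    (trans (cong (_∸ j) (regroup r j)) (m+n∸n≡m (m + r) j))
    where
    regroup : ∀ r j → 2 * suc (r + j) ≡ (suc (suc (r + j)) + r) + j
    regroup = solve-∀
  offset-zy : toℕ (offset z y) ≡ suc (m + r)
  offset-zy = trans (offset-> z y z≡ y≡ (s≤s z≤n))
    (trans (+-identityʳ _) (trans (cong (_∸ suc j) (regroup r j)) (m+n∸n≡m (suc (m + r)) (suc j))))
    where
    regroup : ∀ r j → 2 * suc (suc (r + j)) ≡ suc (suc (suc (r + j)) + r) + suc j
    regroup = solve-∀

  m+m≡ : m + m ≡ suc (suc (2 * k))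
  m+m≡ = trans (cong suc (+-suc k k)) (cong (λ z → suc (suc (k + z))) (sym (+-identityʳ k)))

  M-ll : M l l ≡ true
  M-ll = diagonal l
  M-ly : M l y ≡ false
  M-ly = dec-false (InFamily? m 0 r (toℕ (offset l y))) λ
    { (inj₁ e) → 1+n≢0 (trans (sym offset-ly) e) ; (inj₂ (_ , _ , not-hole)) → not-hole offset-ly }
  M-zl : M z l ≡ false
  M-zl = family-1 m 0 r (s≤s z≤n) (inj₁ (s≤s (s≤s z≤n))) (offset z l) (offset-to-l z 0 z≡ (s≤s z≤n))
  M-zy : M z y ≡ true
  M-zy = in-block (offset z y) (≤-trans (≤-trans (m≤m+n m r) (n≤1+n _)) (≤-reflexive (sym offset-zy)))
    (≤-trans (s≤s (≤-reflexive offset-zy)) (≤-trans (s≤s (s≤s (+-monoʳ-≤ m (m≤m+n r j))))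
      (≤-reflexive (sym (trans (+-suc m (suc (r + j))) (cong suc (+-suc m (r + j))))))))
    λ e → 1+n≰n (≤-reflexive (trans (sym offset-zy) e))
  M-pll : M pl l ≡ true
  M-pll = in-block (offset pl l) (≤-trans (s≤s (m≤m+n k (k + 0))) (≤-reflexive (sym offset-pll)))
    (≤-trans (s≤s (≤-reflexive offset-pll)) (≤-reflexive (sym m+m≡))) not-hole
    where
    offset-pll : toℕ (offset pl l) ≡ suc (2 * k)
    offset-pll = offset-to-l pl (2 * k) pl≡ ≤-refl
    not-hole : toℕ (offset pl l) ≢ m + r
    not-hole e = <-irrefl (suc-injective (trans (sym e) (trans offset-pll (cong (λ z → suc (k + z)) (+-identityʳ k)))))
                          (+-monoʳ-< k r<k)

  open Interchange M l z l y M-ll M-ly M-zl M-zy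

  z≢y : z ≢ y
  z≢y = distinct λ e → 1+n≢0 (sym (trans (sym z≡) (trans e y≡)))
  pl≢z : pl ≢ z
  pl≢z = distinct λ e → 1+n≢0 (trans (sym pl≡) (trans e z≡))
  pl≢l : pl ≢ l
  pl≢l = distinct (<⇒≢ pl<l)
  y<l : toℕ y < toℕ l
  y<l = ≤-trans (s≤s (≤-reflexive y≡)) (≤-trans (s≤s (≤-trans (s≤s (m≤n+m j r)) (m≤m+n k (k + 0)))) (≤-reflexive (sym l≡)))
  y≢l : y ≢ l
  y≢l = distinct (<⇒≢ y<l)
  y+1<l : suc (toℕ y) < toℕ l
  y+1<l = ≤-trans (s≤s (s≤s (≤-reflexive y≡)))
    (≤-trans (s≤s (≤-trans (s≤s (s≤s (m≤n+m j r))) (≤-trans (≤-reflexive (+-comm 1 k)) (+-monoʳ-≤ k (s≤s z≤n)))))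
             (≤-reflexive (sym l≡)))

  shaped′ : Shaped M′
  shaped′ = corner-interchange-shaped M l z y M-ll M-ly M-zl M-zy diagonal (Shaped.subdiagonal-zero shaped)
    l-last z≢y (<⇒≢ y+1<l) (λ e → 1+n≢0 (trans (sym e) z≡)) pl pl+1≡l
    (trans (outside-rows pl l pl≢l pl≢z) M-pll)

  0<l : toℕ z < toℕ l
  0<l = subst₂ _<_ (sym z≡) (sym l≡) (s≤s z≤n)
  0<y : toℕ z < toℕ y
  0<y = subst₂ _<_ (sym z≡) (sym y≡) (s≤s z≤n)

  row-l : count (back M′ l) ≡ suc (count (back M l))
  row-l = count-raise (back M l) (back M′ l) y
    (trans (back-below M l y y<l) M-ly) (trans (back-below M′ l y y<l) M′₁₂) others
    where
    others : ∀ x → x ≢ y → back M′ l x ≡ back M l x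
    others x x≢y = by-cases (x ≟ᶠ l)
      where
      by-cases : Dec (x ≡ l) → back M′ l x ≡ back M l x
      by-cases (yes refl) = trans (back-diagonal M′ l l refl) (sym (back-diagonal M l l refl))
      by-cases (no x≢l)   = back-cong M M′ l x (outside-cols l x x≢l x≢y)

  row-z : count (back M′ z) ≡ count (back M z)
  row-z = count-swap (back M z) (back M′ z) l y
    (trans (back-above M z l 0<l) (cong not M-zl)) (trans (back-above M z y 0<y) (cong not M-zy))
    (trans (back-above M′ z l 0<l) (cong not M′₂₁)) (trans (back-above M′ z y 0<y) (cong not M′₂₂))
    (λ x x≢l x≢y → back-cong M M′ z x (outside-cols z x x≢l x≢y))

  size-back′ : size (back M′) ≡ 1 + size (back M)
  size-back′ = sizeRows-raise (back M) (back M′) l 1 others row-l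
    where
    others : ∀ a → a ≢ l → count (back M′ a) ≡ count (back M a)
    others a a≢l = by-cases (a ≟ᶠ z)
      where
      by-cases : Dec (a ≡ z) → count (back M′ a) ≡ count (back M a)
      by-cases (yes refl) = row-z
      by-cases (no a≢z)   = count-ext (λ b → back-cong M M′ a b (outside-rows a b a≢l a≢z))

  result : HasCriticalOfSize m (1 + (m * m + 2 * (0 * k + r)))
  result = M′ , Λ′ Λ , back M′ , back-critical m M′ (Λ′ Λ) shaped′ , trans size-back′ (cong (1 +_) size-back)

-- Odd sizes m² + 2(qk + r) − 1 (1 ≤ q < m).  Write q = q′ + 1 and
-- k = q′ + i + 1.  Starting from the circulant D m q r, apply the interchange
-- on rows l, l−1 and columns l, q′.  The back set gains (l, q′) but row l−1
-- loses both (l−1, l) and (l−1, q′); the last diagonal entry becomes 0,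
-- rescued by the new 1 at (l−1, l).
module OddBelow (q′ i r : ℕ) (r<k : r < suc (q′ + i)) (small : 1 ≤ i ⊎ r ≡ 0) where
  k q : ℕ
  k = suc (q′ + i)
  q = suc q′
  open Corner k

  small′ : suc q < suc k ⊎ r ≡ 0
  small′ = [ (λ 1≤i → inj₁ (s≤s (s≤s (≤-trans (≤-reflexive (+-comm 1 q′)) (+-monoʳ-≤ q′ 1≤i))))) , inj₂ ]′ small

  open CirculantMember k q r (s≤s (s≤s (m≤m+n q′ i))) (≤-trans r<k (n≤1+n _)) small′ hiding (m)

  q′<k : q′ < k
  q′<k = s≤s (m≤m+n q′ i)
  q′≤2k : q′ ≤ 2 * k
  q′≤2k = ≤-trans (<⇒≤ q′<k) (m≤m+n k (k + 0))

  y : Fin n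
  y = position q′ (≤-trans q′<k (≤-trans (m≤m+n k (k + 0)) (≤-trans (n≤1+n _) (n≤1+n _))))
  y≡ : toℕ y ≡ q′
  y≡ = toℕ-position q′ (≤-trans q′<k (≤-trans (m≤m+n k (k + 0)) (≤-trans (n≤1+n _) (n≤1+n _))))

  L : ℕ
  L = m ∸ q
  L≡ : L ≡ suc i
  L≡ = trans (cong (_∸ q′) (sym (+-suc q′ i))) (m+n∸m≡n q′ (suc i))
  1≤L : 1 ≤ L
  1≤L = ≤-trans (s≤s z≤n) (≤-reflexive (sym L≡))

  offset-ly : toℕ (offset l y) ≡ L + m
  offset-ly = trans (offset-≤ l y l≡ y≡ (≤-trans q′≤2k (n≤1+n _)))
    (trans (cong (_∸ q′) (regroup q′ i)) (trans (m+n∸n≡m (suc i + m) q′) (cong (_+ m) (sym L≡))))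
    where
    regroup : ∀ q′ i → suc (2 * suc (q′ + i)) ≡ (suc i + suc (suc (q′ + i))) + q′
    regroup = solve-∀
  offset-ply : toℕ (offset pl y) ≡ L + k
  offset-ply = trans (offset-≤ pl y pl≡ y≡ q′≤2k)
    (trans (cong (_∸ q′) (regroup q′ i)) (trans (m+n∸n≡m (suc i + k) q′) (cong (_+ k) (sym L≡))))
    where
    regroup : ∀ q′ i → 2 * suc (q′ + i) ≡ (suc i + suc (q′ + i)) + q′
    regroup = solve-∀
  offset-pll : toℕ (offset pl l) ≡ suc (2 * k)
  offset-pll = offset-to-l pl (2 * k) pl≡ ≤-refl

  L+m≤ : L + m ≤ suc (2 * k)
  L+m≤ = ≤-trans (≤-reflexive (cong (_+ m) L≡)) (≤-trans (m≤m+n (suc i + m) q′) (≤-reflexive (regroup q′ i)))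
    where
    regroup : ∀ q′ i → (suc i + suc (suc (q′ + i))) + q′ ≡ suc (2 * suc (q′ + i))
    regroup = solve-∀

  M-ll : M l l ≡ true
  M-ll = diagonal l
  M-ly : M l y ≡ false
  M-ly = dec-false (InFamily? m q r (toℕ (offset l y))) λ
    { (inj₁ e) → <⇒≱ (≤-trans 1≤L (m≤m+n L m)) (≤-reflexive (trans (sym offset-ly) e))
    ; (inj₂ (_ , d<L+m , _)) → <-irrefl offset-ly d<L+m }
  M-pll : M pl l ≡ false
  M-pll = dec-false (InFamily? m q r (toℕ (offset pl l))) λ
    { (inj₁ e) → 1+n≢0 (trans (sym offset-pll) e)
    ; (inj₂ (_ , d<L+m , _)) → <⇒≱ d<L+m (≤-trans L+m≤ (≤-reflexive (sym offset-pll))) }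
  M-ply : M pl y ≡ true
  M-ply = dec-true (InFamily? m q r (toℕ (offset pl y))) (inj₂ (≤-trans (m≤m+n L k) (≤-reflexive (sym offset-ply)) ,
    ≤-trans (s≤s (≤-reflexive offset-ply)) (+-monoʳ-< L (n<1+n k)) ,
    λ e → <-irrefl (+-cancelˡ-≡ L _ _ (trans (sym e) offset-ply)) r<k))

  open Interchange M l pl l y M-ll M-ly M-pll M-ply

  pl≢l : pl ≢ l
  pl≢l = distinct (<⇒≢ pl<l)
  l≢pl : l ≢ pl
  l≢pl = pl≢l ∘ sym
  q′+2≤2k : suc (suc q′) ≤ 2 * k
  q′+2≤2k = ≤-trans (s≤s q′<k) (≤-trans (≤-reflexive (+-comm 1 k)) (+-monoʳ-≤ k (s≤s z≤n)))
  y<pl : toℕ y < toℕ pl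
  y<pl = subst₂ _<_ (sym y≡) (sym pl≡) (≤-trans (n≤1+n _) q′+2≤2k)
  y<l : toℕ y < toℕ l
  y<l = <-trans y<pl pl<l
  y≢l : y ≢ l
  y≢l = distinct (<⇒≢ y<l)

  shaped′ : Shaped M′
  shaped′ = corner-interchange-shaped M l pl y M-ll M-ly M-pll M-ply diagonal (Shaped.subdiagonal-zero shaped)
    l-last (distinct (<⇒≢ y<pl ∘ sym)) (<⇒≢ (≤-trans (s≤s y<pl) (≤-reflexive pl+1≡l)))
    (λ e → <-irrefl (sym (trans (sym pl≡) (trans e (cong suc y≡)))) q′+2≤2k) pl pl+1≡l M′₂₁

  row-l : count (back M′ l) ≡ 1 + count (back M l)
  row-l = count-raise (back M l) (back M′ l) y
    (trans (back-below M l y y<l) M-ly) (trans (back-below M′ l y y<l) M′₁₂) others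
    where
    others : ∀ x → x ≢ y → back M′ l x ≡ back M l x
    others x x≢y = by-cases (x ≟ᶠ l)
      where
      by-cases : Dec (x ≡ l) → back M′ l x ≡ back M l x
      by-cases (yes refl) = trans (back-diagonal M′ l l refl) (sym (back-diagonal M l l refl))
      by-cases (no x≢l)   = back-cong M M′ l x (outside-cols l x x≢l x≢y)

  row-pl : count (back M pl) ≡ 2 + count (back M′ pl)
  row-pl = count-raise₂ (back M′ pl) (back M pl) l y (y≢l ∘ sym)
    (trans (back-above M′ pl l pl<l) (cong not M′₂₁)) (trans (back-below M′ pl y y<pl) M′₂₂)
    (trans (back-above M pl l pl<l) (cong not M-pll)) (trans (back-below M pl y y<pl) M-ply)
    (λ x x≢l x≢y → sym (back-cong M M′ pl x (outside-cols pl x x≢l x≢y)))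

  size-back′ : size (back M′) + 2 ≡ 1 + size (back M)
  size-back′ = sizeRows-raise-lower (back M) (back M′) l pl 1 2 l≢pl
    (λ a a≢l a≢pl → count-ext (λ b → back-cong M M′ a b (outside-rows a b a≢l a≢pl))) row-l row-pl

  result : ∀ s → 1 + s ≡ m * m + 2 * (q * k + r) → HasCriticalOfSize m s
  result s 1+s≡ = M′ , Λ′ Λ , back M′ , back-critical m M′ (Λ′ Λ) shaped′ ,
    +-cancelʳ-≡ 2 (size (back M′)) s (begin
      size (back M′) + 2             ≡⟨ size-back′ ⟩
      1 + size (back M)              ≡⟨ cong (1 +_) (trans size-back (sym 1+s≡)) ⟩
      1 + (1 + s)                    ≡⟨ +-comm 2 s ⟩
      s + 2                          ∎)
    where open ≡-Reasoning

decompose : ∀ k′ s → s ≤ suc k′ * suc k′ → Σ ℕ λ q → Σ ℕ λ r →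
  r < suc k′ × q ≤ suc k′ × q * suc k′ + r ≡ s × (q < suc k′ ⊎ r ≡ 0)
decompose k′ s s≤k² = q , r , m%n<n s k , q≤k , q*k+r≡s , small (m≤n⇒m<n∨m≡n q≤k)
  where
  k q r : ℕ
  k = suc k′
  q = s / k
  r = s % k
  q*k+r≡s : q * k + r ≡ s
  q*k+r≡s = trans (+-comm (q * k) r) (sym (m≡m%n+[m/n]*n s k))
  q≤k : q ≤ k
  q≤k = *-cancelʳ-≤ q k k (≤-trans (m/n*n≤m s k) s≤k²)
  small : q < k ⊎ q ≡ k → q < k ⊎ r ≡ 0
  small (inj₁ q<k) = inj₁ q<k
  small (inj₂ q≡k) = inj₂ (n≤0⇒n≡0 (+-cancelʳ-≤ (k * k) r 0 (≤-trans (≤-reflexive k²+r≡s) s≤k²)))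
    where
    k²+r≡s : r + k * k ≡ s
    k²+r≡s = trans (+-comm r (k * k)) (trans (cong (λ z → z * k + r) (sym q≡k)) q*k+r≡s)

even-sizes : ∀ k s → s ≤ k * k → HasCriticalOfSize (suc k) (suc k * suc k + 2 * s)
even-sizes zero zero _ = M , Λ , back M , back-critical 1 M Λ shaped , size-back
  where open CirculantMember 0 0 0 (s≤s z≤n) (s≤s z≤n) (inj₂ refl)
even-sizes (suc k′) s s≤k² with decompose k′ s s≤k²
... | q , r , r<k , q≤k , refl , small =
  M , Λ , back M , back-critical m M Λ shaped , size-back
  where open CirculantMember (suc k′) q r (s≤s q≤k) (≤-trans r<k (n≤1+n _)) ([ inj₁ ∘ s≤s , inj₂ ]′ small)

odd-above : ∀ k r → r < k → HasCriticalOfSize (suc k) (suc k * suc k + suc (2 * r))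
odd-above (suc k′) r (s≤s r≤k′) =
  subst (λ k → HasCriticalOfSize (suc k) (suc k * suc k + suc (2 * r))) k≡
    (subst (HasCriticalOfSize (suc (suc (r + j)))) (regroup (suc (r + j)) r) (OddAbove.result r j))
  where
  j : ℕ
  j = k′ ∸ r
  k≡ : suc (r + j) ≡ suc k′
  k≡ = cong suc (m+[n∸m]≡n r≤k′)
  regroup : ∀ k r → 1 + (suc k * suc k + 2 * (0 * k + r)) ≡ suc k * suc k + suc (2 * r)
  regroup = solve-∀

odd-below : ∀ k q r → 1 ≤ q → q ≤ k → r < k → (q < k ⊎ r ≡ 0) →
  ∀ s → 1 + s ≡ suc k * suc k + 2 * (q * k + r) → HasCriticalOfSize (suc k) s
odd-below k (suc q′) r _ q≤k r<k small =
  subst (λ k → r < k → ∀ s → 1 + s ≡ suc k * suc k + 2 * (suc q′ * k + r) → HasCriticalOfSize (suc k) s)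
    k≡ (λ r<k → OddBelow.result q′ i r r<k small′) r<k
  where
  i : ℕ
  i = k ∸ suc q′
  k≡ : suc (q′ + i) ≡ k
  k≡ = m+[n∸m]≡n q≤k
  small′ : 1 ≤ i ⊎ r ≡ 0
  small′ = [ inj₁ ∘ m<n⇒0<n∸m , inj₂ ]′ small

odd-sizes : ∀ k t → suc t ≤ k * k → HasCriticalOfSize (suc k) (suc k * suc k + suc (2 * t))
odd-sizes (suc k′) t t<k² with t <? suc k′
... | yes t<k = odd-above (suc k′) t t<k
... | no t≮k with decompose k′ (suc t) t<k²
... | zero , r , r<k , _ , refl , _ = ⊥-elim (t≮k (≤-trans (n≤1+n (suc t)) r<k))
... | suc q′ , r , r<k , q≤k , t+1≡ , small =
  odd-below (suc k′) (suc q′) r (s≤s z≤n) q≤k r<k small _ (trans (regroup (suc k * suc k) t) (cong (λ z → suc k * suc k + 2 * z) (sym t+1≡)))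
  where
  k : ℕ
  k = suc k′
  regroup : ∀ A t → 1 + (A + suc (2 * t)) ≡ A + 2 * suc t
  regroup = solve-∀

parity : ∀ d → Σ ℕ λ h → d ≡ 2 * h ⊎ d ≡ suc (2 * h)
parity zero = 0 , inj₁ refl
parity (suc d) with parity d
... | h , inj₁ e = h , inj₂ (cong suc e)
... | h , inj₂ e = suc h , inj₁ (trans (cong suc e) (two-more h))
  where
  two-more : ∀ h → suc (suc (2 * h)) ≡ 2 * suc h
  two-more = solve-∀

theorem17 : ∀ (m : ℕ) → 1 ≤ m → ∀ (k : ℕ) → m * m ≤ k → k ≤ 3 * m * m + 2 ∸ 4 * m →
    ∃[ M ] (InΛ (2 * m) m M × ∃[ S ] (IsCritical m M S × size S ≡ k))
theorem17 (suc k) _ s m²≤s s≤top = subst (HasCriticalOfSize m) (m+[n∸m]≡n m²≤s) (by-parity (parity d))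
  where
  m d : ℕ
  m = suc k
  d = s ∸ m * m
  top≡ : 3 * m * m + 2 ∸ 4 * m ≡ m * m + 2 * (k * k)
  top≡ = trans (cong (_∸ 4 * m) (expand k)) (m+n∸n≡m (m * m + 2 * (k * k)) (4 * m))
    where
    expand : ∀ k → 3 * suc k * suc k + 2 ≡ (suc k * suc k + 2 * (k * k)) + 4 * suc k
    expand = solve-∀
  d≤ : d ≤ 2 * (k * k)
  d≤ = +-cancelˡ-≤ (m * m) d (2 * (k * k))
         (≤-trans (≤-reflexive (m+[n∸m]≡n m²≤s)) (≤-trans s≤top (≤-reflexive top≡)))
  by-parity : (Σ ℕ λ h → d ≡ 2 * h ⊎ d ≡ suc (2 * h)) → HasCriticalOfSize m (m * m + d)
  by-parity (h , inj₁ d≡) = subst (λ e → HasCriticalOfSize m (m * m + e)) (sym d≡)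
    (even-sizes k h (*-cancelˡ-≤ 2 (≤-trans (≤-reflexive (sym d≡)) d≤)))
  by-parity (h , inj₂ d≡) = subst (λ e → HasCriticalOfSize m (m * m + e)) (sym d≡)
    (odd-sizes k h (*-cancelˡ-< 2 h (k * k) (≤-trans (≤-reflexive (sym d≡)) d≤)))
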